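{- For each vincular pattern $\tau\in\{2\text{ - }13,\,2\text{ - }31,\,13\text{ - }2,\,31\text{ - }2\}$, let $\tau(\sigma)$ denote the number of occurrences of $\tau$ in $\sigma$. Then, as formal power series in $t$, $$\sum_{n\ge0}\sum_{\sigma\in\mathfrak{S}_n}q^{\tau(\sigma)}t^n=\cfrac{1}{1-\cfrac{[1]_q t}{1-\cfrac{[1]_q t}{1-\cfrac{[2]_q t}{1-\cfrac{[2]_q t}{1-\cdots}}}}},$$ i.e. the Stieltjes-type continued fraction with coefficients $\alpha_{2k-1}=\alpha_{2k}=[k]_q$ for $k\ge1$. Hence each of these statistics exhibits the cyclic sieving phenomenon with respect to involutions that have $1$ fixed point when $n=0$ and $2^{n-1}$ fixed points when $n\ge1$.
   Context: $\mathfrak{S}_n$ is the set of permutations $\sigma=\sigma_1\cdots\sigma_n$ of $[n]$, and $[k]_q=1+q+\dots+q^{k-1}$. An occurrence of the vincular pattern $2\text{ - }13$ in $\sigma$ is a pair of positions $i<j\le n-1$ with $\sigma_j<\sigma_i<\sigma_{j+1}$; of $2\text{ - }31$: $i<j\le n-1$ with $\sigma_{j+1}<\sigma_i<\sigma_j$; of $13\text{ - }2$: $i<i+1<k$ with $\sigma_i<\sigma_k<\sigma_{i+1}$; of $31\text{ - }2$: $i<i+1<k$ with $\sigma_{i+1}<\sigma_k<\sigma_i$ (the letters joined without a dash must be adjacent positions). Cyclic sieving for involutions: for an involution $\phi$ on a finite set $X$ and polynomial $f$, $(X,\{\mathrm{id},\phi\},f)$ exhibits the CSP iff $f(1)=|X|$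 and $f(-1)$ equals the number of fixed points of $\phi$; a statistic exhibits the CSP with respect to involutions having $a_n$ fixed points if for every $n$ and every involution $\phi$ of $\mathfrak{S}_n$ with exactly $a_n$ fixed points, $(\mathfrak{S}_n,\{\mathrm{id},\phi\},\sum_{\sigma}q^{\mathrm{stat}(\sigma)})$ exhibits the CSP. -}

module Defs where

open import Data.Nat using (ℕ; zero; suc; _+_; _*_; _∸_; _^_; _<ᵇ_; _≡ᵇ_; ⌊_/2⌋)
open import Data.Bool using (Bool; true; false; if_then_else_; _∧_)
open import Data.List using (List; []; _∷_; length; map; concatMap; filterᵇ; upTo; foldr)
open import Data.List.Membership.Propositional using (_∈_)
open import Data.Integer as ℤ using (ℤ; +_)
open import Data.Product using (_×_)
open import Relation.Binary.PropositionalEquality using (_≡_)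
open import Data.List.Properties using (≡-dec)
open import Data.Nat.Properties using () renaming (_≟_ to _≟ℕ_)
open import Relation.Nullary using (does)

sumℕ : ℕ → (ℕ → ℕ) → ℕ
sumℕ zero    f = 0
sumℕ (suc n) f = sumℕ n f + f n

-- Polynomials in q (coefficient functions, coefficient of q^k)
-- and formal power series in t with polynomial coefficients.

Poly : Set
Poly = ℕ → ℕ

Series : Set
Series = ℕ → Poly

pzero : Poly
pzero _ = 0

pone : Poly
pone zero    = 1
pone (suc _) = 0

padd : Poly → Poly → Poly
padd p r k = p k + r k

pmul : Poly → Poly → Poly
pmul p r k = sumℕ (suc k) (λ i → p i * r (k ∸ i))

psum : ℕ → (ℕ → Poly) → Poly
psum zero    f = pzero
psum (suc n) f = padd (psum n f) (f n)

sone : Series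
sone zero    = pone
sone (suc _) = pzero

smul : Series → Series → Series
smul A B n = psum (suc n) (λ i → pmul (A i) (B (n ∸ i)))

spow : Series → ℕ → Series
spow G zero    = sone
spow G (suc k) = smul G (spow G k)

-- 1 / (1 - G) = Σ_k G^k, for G with zero constant term
-- (coefficient of t^n only involves k ≤ n).
inv1m : Series → Series
inv1m G n = psum (suc n) (λ k → spow G k n)

qint : ℕ → Poly
qint m k = if k <ᵇ m then 1 else 0

-- S-fraction coefficients α_{2k-1} = α_{2k} = [k]_q  (i ≥ 1)
α : ℕ → Poly
α i = qint ⌊ suc i /2⌋

tmul : ℕ → Series → Series
tmul j F zero    = pzero
tmul j F (suc n) = pmul (α j) (F n)

-- The continued fraction 1/(1 - α_1 t/(1 - α_2 t/(1 - ...))) is the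
-- t-adic limit of cf d 1 as d → ∞.
cf : ℕ → ℕ → Series
cf zero    j = sone
cf (suc d) j = inv1m (tmul j (cf d (suc j)))

-- Permutations of [n] = {1,…,n} as words σ₁⋯σₙ (lists of naturals).

vals : ℕ → List ℕ
vals m = map suc (upTo m)

words : ℕ → ℕ → List (List ℕ)
words zero    m = [] ∷ []
words (suc l) m = concatMap (λ v → map (v ∷_) (words l m)) (vals m)

countOcc : ℕ → List ℕ → ℕ
countOcc v xs = length (filterᵇ (λ x → x ≡ᵇ v) xs)

-- a word of length n over [n] is a permutation iff each v ∈ [n] occurs once
allᵇ : (ℕ → Bool) → List ℕ → Bool
allᵇ p []       = true
allᵇ p (x ∷ xs) = p x ∧ allᵇ p xs

isPerm : ℕ → List ℕ → Bool
isPerm n σ = allᵇ (λ v → countOcc v σ ≡ᵇ 1) (vals n)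

perms : ℕ → List (List ℕ)
perms n = filterᵇ (isPerm n) (words n n)

-- Vincular patterns (positions are 0-indexed here: σ_i = at σ i)

at : List ℕ → ℕ → ℕ
at []       _       = 0
at (x ∷ xs) zero    = x
at (x ∷ xs) (suc i) = at xs i

countPairs : ℕ → (ℕ → ℕ → Bool) → ℕ
countPairs n P = sumℕ n (λ i → sumℕ n (λ j → if P i j then 1 else 0))

data Pattern : Set where
  p2-13 p2-31 p13-2 p31-2 : Pattern

occ : Pattern → List ℕ → ℕ
occ p2-13 σ = countPairs (length σ) (λ i j →
  (i <ᵇ j) ∧ (suc j <ᵇ length σ) ∧ (at σ j <ᵇ at σ i) ∧ (at σ i <ᵇ at σ (suc j)))
occ p2-31 σ = countPairs (length σ) (λ i j →
  (i <ᵇ j) ∧ (suc j <ᵇ length σ) ∧ (at σ (suc j) <ᵇ at σ i) ∧ (at σ i <ᵇ at σ j))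
occ p13-2 σ = countPairs (length σ) (λ i k →
  (suc i <ᵇ k) ∧ (at σ i <ᵇ at σ k) ∧ (at σ k <ᵇ at σ (suc i)))
occ p31-2 σ = countPairs (length σ) (λ i k →
  (suc i <ᵇ k) ∧ (at σ (suc i) <ᵇ at σ k) ∧ (at σ k <ᵇ at σ i))

genCoeff : (List ℕ → ℕ) → ℕ → Poly
genCoeff stat n k = length (filterᵇ (λ σ → stat σ ≡ᵇ k) (perms n))

genEval : (List ℕ → ℕ) → ℕ → ℤ → ℤ
genEval stat n q = foldr (λ σ acc → (q ℤ.^ stat σ) ℤ.+ acc) (+ 0) (perms n)

IsInvolutionOn : List (List ℕ) → (List ℕ → List ℕ) → Set
IsInvolutionOn X φ = ∀ σ → σ ∈ X → (φ σ ∈ X) × (φ (φ σ) ≡ σ)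

fixCount : List (List ℕ) → (List ℕ → List ℕ) → ℕ
fixCount X φ = length (filterᵇ (λ σ → does (≡-dec _≟ℕ_ (φ σ) σ)) X)

CSP : List (List ℕ) → (List ℕ → List ℕ) → (ℤ → ℤ) → Set
CSP X φ f = (f (+ 1) ≡ + length X) × (f (ℤ.- (+ 1)) ≡ + fixCount X φ)

ExhibitsCSP : (List ℕ → ℕ) → (ℕ → ℕ) → Set
ExhibitsCSP stat a = ∀ n (φ : List ℕ → List ℕ) →
  IsInvolutionOn (perms n) φ → fixCount (perms n) φ ≡ a n →
  CSP (perms n) φ (genEval stat n)

fixNum : ℕ → ℕ
fixNum zero    = 1
fixNum (suc n) = 2 ^ n

{-# OPTIONS --safe #-}
-- Insert the values 1, 2, …, n one after the other into the word 0 0.  Once 1, …, m are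
-- placed, the letters ≤ m of 0σ0 form maximal blocks separated by gaps that larger letters
-- will fill, and m + 1 enters one of these gaps: it fills the gap, joins the block on its
-- left or on its right, or stands alone inside it.  Entering a gap with g gaps to its left
-- creates exactly g occurrences of 31-2 whose 2 is m + 1, so on 𝔖ₙ the statistic 31-2 is
-- distributed like the sum of the chosen gap indices.  Counting by the number x of gaps,
-- these distributions satisfy the weighted Motzkin path recurrence
--   P_{r+1}(x) = [x]_q (P_r(x - 1) + 2 P_r(x) + P_r(x + 1)),
-- and so do the coefficients of the products Φ_{x-1} ⋯ Φ_0, where 1 + Φ_h is the tail of
-- the S-fraction starting at α_{2h+1} = α_{2h+2} = [h+1]_q: the equations of two consecutive
-- tails combine into Φ_h = [h+1]_q t (1 + 2 Φ_h + Φ_{h+1} Φ_h).  Reversal and complementation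
-- carry 2-13, 2-31 and 13-2 to 31-2.  At q = -1 the weight [2]_q vanishes, so only the paths
-- staying at height 1 survive, and there are 2^{n-1} of them.

module Submission where

open import Defs
open import Algebra using (CommutativeSemiring)
import Algebra.Definitions.RawSemiring as RawSemiringDefinitions
import Algebra.Solver.Ring.NaturalCoefficients.Default as NaturalCoefficientsSolver
import Algebra.Structures.Biased as Biased
open import Data.Bool using (Bool; true; false; if_then_else_; _∧_; T)
open import Data.Bool.Properties using (∧-zeroʳ; ∧-identityʳ; ∧-comm; T-≡)
open import Data.Empty using (⊥; ⊥-elim)
open import Data.List using (List; []; _∷_; _++_; [_]; length; map; concat; concatMap; filterᵇ; foldr; upTo; reverse)
import Data.List.Properties as Listₚ
open import Data.List.Membership.Propositional using (_∈_)
open import Data.List.Membership.Propositional.Properties using (∈-map⁺; ∈-upTo⁺)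
open import Data.List.Relation.Unary.All as All using (All; []; _∷_)
import Data.List.Relation.Unary.All.Properties as Allₚ
open import Data.List.Relation.Binary.Permutation.Propositional as ↭
  using (_↭_; ↭-refl; ↭-prep; ↭-trans; ↭-sym; ↭-reflexive; module PermutationReasoning)
import Data.List.Relation.Binary.Permutation.Propositional.Properties as ↭ₚ
open import Data.Maybe as Maybe using (Maybe; just; nothing)
open import Data.Nat as ℕ using (ℕ; zero; suc; _∸_; _<_; _≤_; _⊓_; z≤n; s≤s; _<ᵇ_; _≤ᵇ_; _≡ᵇ_)
import Data.Nat.Properties as ℕₚ
open import Data.Product as Product using (_×_; _,_; proj₁; proj₂; ∃-syntax)
open import Data.Product.Properties using (,-injective)
open import Data.Sum using (_⊎_; inj₁; inj₂)
open import Data.Unit using (⊤; tt)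
open import Function using (_∘_; Equivalence; mk⇔)
open import Relation.Binary.Definitions using (DecidableEquality; tri<; tri≈; tri>)
open import Relation.Binary.PropositionalEquality as ≡ using (_≡_; _≢_; refl; cong; cong₂)
import Relation.Binary.Reasoning.Setoid as SetoidReasoning
open import Relation.Binary.Structures using (IsEquivalence)
open import Relation.Nullary using (¬_; Dec; does; proof)
open import Relation.Nullary.Decidable using (does-⇔; dec-true; dec-false; T?)
open import Relation.Nullary.Reflects as Reflects using (Reflects; ofʸ; ofⁿ; _×-reflects_)

-- Finite sums and formal power series

module FiniteSum {c ℓ} (R : CommutativeSemiring c ℓ) where
  open CommutativeSemiring R renaming (refl to ≈-refl)
  open SetoidReasoning setoid

  ∑ : ℕ → (ℕ → Carrier) → Carrier
  ∑ zero    f = 0#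
  ∑ (suc n) f = ∑ n f + f n

  ∑-cong-< : ∀ n {f g : ℕ → Carrier} → (∀ i → i < n → f i ≈ g i) → ∑ n f ≈ ∑ n g
  ∑-cong-< zero    f≈g = ≈-refl
  ∑-cong-< (suc n) f≈g = +-cong (∑-cong-< n (λ i i<n → f≈g i (ℕₚ.m≤n⇒m≤1+n i<n))) (f≈g n ℕₚ.≤-refl)

  ∑-cong : ∀ n {f g : ℕ → Carrier} → (∀ i → f i ≈ g i) → ∑ n f ≈ ∑ n g
  ∑-cong n f≈g = ∑-cong-< n (λ i _ → f≈g i)

  ∑-zero : ∀ n {f : ℕ → Carrier} → (∀ i → i < n → f i ≈ 0#) → ∑ n f ≈ 0#
  ∑-zero zero    f≈0 = ≈-refl
  ∑-zero (suc n) f≈0 =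
    trans (+-cong (∑-zero n (λ i i<n → f≈0 i (ℕₚ.m≤n⇒m≤1+n i<n))) (f≈0 n ℕₚ.≤-refl)) (+-identityˡ 0#)

  ∑-distrib-+ : ∀ n (f g : ℕ → Carrier) → ∑ n (λ i → f i + g i) ≈ ∑ n f + ∑ n g
  ∑-distrib-+ zero    f g = sym (+-identityˡ 0#)
  ∑-distrib-+ (suc n) f g = begin
    ∑ n (λ i → f i + g i) + (f n + g n) ≈⟨ +-congʳ (∑-distrib-+ n f g) ⟩
    (∑ n f + ∑ n g) + (f n + g n)       ≈⟨ +-assoc _ _ _ ⟩
    ∑ n f + (∑ n g + (f n + g n))       ≈⟨ +-congˡ (sym (+-assoc _ _ _)) ⟩
    ∑ n f + ((∑ n g + f n) + g n)       ≈⟨ +-congˡ (+-congʳ (+-comm _ _)) ⟩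
    ∑ n f + ((f n + ∑ n g) + g n)       ≈⟨ +-congˡ (+-assoc _ _ _) ⟩
    ∑ n f + (f n + (∑ n g + g n))       ≈⟨ sym (+-assoc _ _ _) ⟩
    (∑ n f + f n) + (∑ n g + g n)       ∎

  ∑-distribˡ : ∀ n a (f : ℕ → Carrier) → a * ∑ n f ≈ ∑ n (λ i → a * f i)
  ∑-distribˡ zero    a f = zeroʳ a
  ∑-distribˡ (suc n) a f = trans (distribˡ a _ _) (+-congʳ (∑-distribˡ n a f))

  ∑-distribʳ : ∀ n a (f : ℕ → Carrier) → ∑ n f * a ≈ ∑ n (λ i → f i * a)
  ∑-distribʳ n a f = trans (*-comm _ _) (trans (∑-distribˡ n a f) (∑-cong n (λ i → *-comm _ _)))

  ∑-unfoldˡ : ∀ n (f : ℕ → Carrier) → ∑ (suc n) f ≈ f 0 + ∑ n (λ i → f (suc i))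
  ∑-unfoldˡ zero    f = trans (+-identityˡ _) (sym (+-identityʳ _))
  ∑-unfoldˡ (suc n) f = trans (+-congʳ (∑-unfoldˡ n f)) (+-assoc _ _ _)

  ∑-swap : ∀ n m (F : ℕ → ℕ → Carrier) → ∑ n (λ i → ∑ m (F i)) ≈ ∑ m (λ j → ∑ n (λ i → F i j))
  ∑-swap zero    m F = sym (∑-zero m (λ _ _ → ≈-refl))
  ∑-swap (suc n) m F = begin
    ∑ n (λ i → ∑ m (F i)) + ∑ m (F n)                 ≈⟨ +-congʳ (∑-swap n m F) ⟩
    ∑ m (λ j → ∑ n (λ i → F i j)) + ∑ m (F n)         ≈⟨ sym (∑-distrib-+ m _ _) ⟩
    ∑ m (λ j → ∑ n (λ i → F i j) + F n j)             ∎

  ∑-reverse : ∀ n (f : ℕ → Carrier) → ∑ n f ≈ ∑ n (λ i → f (n ∸ suc i))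
  ∑-reverse zero    f = ≈-refl
  ∑-reverse (suc n) f = begin
    ∑ n f + f n                         ≈⟨ +-comm _ _ ⟩
    f n + ∑ n f                         ≈⟨ +-congˡ (∑-reverse n f) ⟩
    f n + ∑ n (λ i → f (n ∸ suc i))     ≈⟨ sym (∑-unfoldˡ n (λ i → f (n ∸ i))) ⟩
    ∑ (suc n) (λ i → f (n ∸ i))         ∎

  ∑-pad : ∀ {n} m {f : ℕ → Carrier} → n ≤ m → (∀ i → n ≤ i → i < m → f i ≈ 0#) → ∑ m f ≈ ∑ n f
  ∑-pad m n≤m f≈0 with ℕₚ.m≤n⇒m<n∨m≡n n≤m
  ... | inj₂ refl = ≈-refl
  ∑-pad (suc m) _ f≈0 | inj₁ (s≤s n≤m) =
    trans (+-cong (∑-pad m n≤m (λ i n≤i i<m → f≈0 i n≤i (ℕₚ.m≤n⇒m≤1+n i<m))) (f≈0 m n≤m ℕₚ.≤-refl))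
          (+-identityʳ _)

  ∑-triangle : ∀ n (F : ℕ → ℕ → Carrier) →
    ∑ n (λ i → ∑ (suc i) (F i)) ≈ ∑ n (λ j → ∑ (n ∸ j) (λ l → F (j ℕ.+ l) j))
  ∑-triangle zero    F = ≈-refl
  ∑-triangle (suc n) F = begin
    ∑ n (λ i → ∑ (suc i) (F i)) + (∑ n (F n) + F n n)
      ≈⟨ trans (+-congʳ (∑-triangle n F)) (sym (+-assoc _ _ _)) ⟩
    (∑ n (λ j → ∑ (n ∸ j) (λ l → F (j ℕ.+ l) j)) + ∑ n (F n)) + F n n
      ≈⟨ +-cong (sym (∑-distrib-+ n _ _)) diagonal ⟩
    ∑ n (λ j → ∑ (n ∸ j) (λ l → F (j ℕ.+ l) j) + F n j) + ∑ (suc n ∸ n) (λ l → F (n ℕ.+ l) n)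
      ≈⟨ +-congʳ (∑-cong-< n column) ⟩
    ∑ n (λ j → ∑ (suc n ∸ j) (λ l → F (j ℕ.+ l) j)) + ∑ (suc n ∸ n) (λ l → F (n ℕ.+ l) n) ∎
    where
    diagonal : F n n ≈ ∑ (suc n ∸ n) (λ l → F (n ℕ.+ l) n)
    diagonal = begin
      F n n
        ≈⟨ sym (+-identityˡ _) ⟩
      0# + F n n
        ≡⟨ ≡.cong (λ k → 0# + F k n) (≡.sym (ℕₚ.+-identityʳ n)) ⟩
      ∑ 1 (λ l → F (n ℕ.+ l) n)
        ≡⟨ ≡.cong (λ k → ∑ k (λ l → F (n ℕ.+ l) n)) (≡.sym (ℕₚ.m+n∸n≡m 1 n)) ⟩
      ∑ (suc n ∸ n) (λ l → F (n ℕ.+ l) n) ∎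
    column : ∀ j → j < n → ∑ (n ∸ j) (λ l → F (j ℕ.+ l) j) + F n j ≈ ∑ (suc n ∸ j) (λ l → F (j ℕ.+ l) j)
    column j j<n = begin
      ∑ (n ∸ j) (λ l → F (j ℕ.+ l) j) + F n j
        ≡⟨ ≡.cong (λ k → ∑ (n ∸ j) (λ l → F (j ℕ.+ l) j) + F k j)
                  (≡.sym (ℕₚ.m+[n∸m]≡n (ℕₚ.<⇒≤ j<n))) ⟩
      ∑ (suc (n ∸ j)) (λ l → F (j ℕ.+ l) j)
        ≡⟨ ≡.cong (λ k → ∑ k (λ l → F (j ℕ.+ l) j)) (≡.sym (ℕₚ.+-∸-assoc 1 (ℕₚ.<⇒≤ j<n))) ⟩
      ∑ (suc n ∸ j) (λ l → F (j ℕ.+ l) j) ∎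

module PowerSeries {c ℓ} (R : CommutativeSemiring c ℓ) where
  open CommutativeSemiring R renaming (refl to ≈-refl)
  open FiniteSum R
  open SetoidReasoning setoid

  Seq : Set c
  Seq = ℕ → Carrier

  infix 4 _≋_
  _≋_ : Seq → Seq → Set ℓ
  f ≋ g = ∀ n → f n ≈ g n

  ≋-isEquivalence : IsEquivalence _≋_
  ≋-isEquivalence = record
    { refl = λ _ → ≈-refl ; sym = λ f≋g n → sym (f≋g n) ; trans = λ f≋g g≋h n → trans (f≋g n) (g≋h n) }

  -- Opaque, so that unification does not unfold coefficient sums (this keeps the ring
  -- solver steps below fast); the lemmas ending in -coeff give access to the coefficients.
  opaque
    infixl 6 _⊕_
    infixl 7 _⊛_

    _⊕_ : Seq → Seq → Seq
    (f ⊕ g) n = f n + g n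

    _⊛_ : Seq → Seq → Seq
    (f ⊛ g) n = ∑ (suc n) (λ i → f i * g (n ∸ i))

    𝟘 : Seq
    𝟘 _ = 0#

    𝟙 : Seq
    𝟙 zero    = 1#
    𝟙 (suc _) = 0#

    ⊕-coeff : ∀ f g n → (f ⊕ g) n ≡ f n + g n
    ⊕-coeff f g n = refl

    ⊛-coeff : ∀ f g n → (f ⊛ g) n ≡ ∑ (suc n) (λ i → f i * g (n ∸ i))
    ⊛-coeff f g n = refl

    𝟘-coeff : ∀ n → 𝟘 n ≡ 0#
    𝟘-coeff n = refl

    𝟙-coeff-zero : 𝟙 0 ≡ 1#
    𝟙-coeff-zero = refl

    𝟙-coeff-suc : ∀ n → 𝟙 (suc n) ≡ 0#
    𝟙-coeff-suc n = refl

    ⊕-cong : ∀ {f f′ g g′} → f ≋ f′ → g ≋ g′ → f ⊕ g ≋ f′ ⊕ g′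
    ⊕-cong f≋f′ g≋g′ n = +-cong (f≋f′ n) (g≋g′ n)

    ⊕-assoc : ∀ f g h → (f ⊕ g) ⊕ h ≋ f ⊕ (g ⊕ h)
    ⊕-assoc f g h n = +-assoc _ _ _

    ⊕-comm : ∀ f g → f ⊕ g ≋ g ⊕ f
    ⊕-comm f g n = +-comm _ _

    ⊕-identityˡ : ∀ f → 𝟘 ⊕ f ≋ f
    ⊕-identityˡ f n = +-identityˡ _

    ⊛-cong : ∀ {f f′ g g′} → f ≋ f′ → g ≋ g′ → f ⊛ g ≋ f′ ⊛ g′
    ⊛-cong f≋f′ g≋g′ n = ∑-cong (suc n) (λ i → *-cong (f≋f′ i) (g≋g′ (n ∸ i)))

    ⊛-comm : ∀ f g → f ⊛ g ≋ g ⊛ f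
    ⊛-comm f g n = begin
      ∑ (suc n) (λ i → f i * g (n ∸ i))              ≈⟨ ∑-reverse (suc n) _ ⟩
      ∑ (suc n) (λ i → f (n ∸ i) * g (n ∸ (n ∸ i)))  ≈⟨ ∑-cong-< (suc n) reindex ⟩
      ∑ (suc n) (λ i → g i * f (n ∸ i))              ∎
      where
      reindex : ∀ i → i < suc n → f (n ∸ i) * g (n ∸ (n ∸ i)) ≈ g i * f (n ∸ i)
      reindex i (s≤s i≤n) = trans (*-comm _ _) (*-congʳ (reflexive (≡.cong g (ℕₚ.m∸[m∸n]≡n i≤n))))

    ⊛-assoc : ∀ f g h → (f ⊛ g) ⊛ h ≋ f ⊛ (g ⊛ h)
    ⊛-assoc f g h n = begin
      ∑ (suc n) (λ i → ∑ (suc i) (λ j → f j * g (i ∸ j)) * h (n ∸ i))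
        ≈⟨ ∑-cong (suc n) (λ i → trans (∑-distribʳ (suc i) _ _) (∑-cong (suc i) (λ j → *-assoc _ _ _))) ⟩
      ∑ (suc n) (λ i → ∑ (suc i) (λ j → f j * (g (i ∸ j) * h (n ∸ i))))
        ≈⟨ ∑-triangle (suc n) (λ i j → f j * (g (i ∸ j) * h (n ∸ i))) ⟩
      ∑ (suc n) (λ j → ∑ (suc n ∸ j) (λ l → f j * (g ((j ℕ.+ l) ∸ j) * h (n ∸ (j ℕ.+ l)))))
        ≈⟨ ∑-cong-< (suc n) inner ⟩
      ∑ (suc n) (λ j → f j * ∑ (suc (n ∸ j)) (λ l → g l * h ((n ∸ j) ∸ l))) ∎
      where
      inner : ∀ j → j < suc n →
        ∑ (suc n ∸ j) (λ l → f j * (g ((j ℕ.+ l) ∸ j) * h (n ∸ (j ℕ.+ l)))) ≈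
        f j * ∑ (suc (n ∸ j)) (λ l → g l * h ((n ∸ j) ∸ l))
      inner j (s≤s j≤n) = begin
        ∑ (suc n ∸ j) (λ l → f j * (g ((j ℕ.+ l) ∸ j) * h (n ∸ (j ℕ.+ l))))
          ≡⟨ ≡.cong (λ k → ∑ k (λ l → f j * (g ((j ℕ.+ l) ∸ j) * h (n ∸ (j ℕ.+ l))))) (ℕₚ.+-∸-assoc 1 j≤n) ⟩
        ∑ (suc (n ∸ j)) (λ l → f j * (g ((j ℕ.+ l) ∸ j) * h (n ∸ (j ℕ.+ l))))
          ≈⟨ ∑-cong (suc (n ∸ j)) (λ l → *-congˡ (*-cong (reflexive (≡.cong g (ℕₚ.m+n∸m≡n j l)))
                                                         (reflexive (≡.cong h (≡.sym (ℕₚ.∸-+-assoc n j l)))))) ⟩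
        ∑ (suc (n ∸ j)) (λ l → f j * (g l * h ((n ∸ j) ∸ l)))
          ≈⟨ sym (∑-distribˡ (suc (n ∸ j)) _ _) ⟩
        f j * ∑ (suc (n ∸ j)) (λ l → g l * h ((n ∸ j) ∸ l)) ∎

    ⊛-identityˡ : ∀ f → 𝟙 ⊛ f ≋ f
    ⊛-identityˡ f n = begin
      ∑ (suc n) (λ i → 𝟙 i * f (n ∸ i))              ≈⟨ ∑-unfoldˡ n _ ⟩
      1# * f n + ∑ n (λ i → 0# * f (n ∸ suc i))      ≈⟨ +-cong (*-identityˡ _) (∑-zero n (λ _ _ → zeroˡ _)) ⟩
      f n + 0#                                       ≈⟨ +-identityʳ _ ⟩
      f n                                            ∎

    ⊛-zeroˡ : ∀ f → 𝟘 ⊛ f ≋ 𝟘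
    ⊛-zeroˡ f n = ∑-zero (suc n) (λ _ _ → zeroˡ _)

    ⊛-distribʳ : ∀ f g h → (g ⊕ h) ⊛ f ≋ g ⊛ f ⊕ h ⊛ f
    ⊛-distribʳ f g h n = trans (∑-cong (suc n) (λ _ → distribʳ _ _ _)) (∑-distrib-+ (suc n) _ _)

    ⊛-coeff-cong-≤ : ∀ {f f′ g g′} n → (∀ i → i ≤ n → f i ≈ f′ i) → (∀ i → i ≤ n → g i ≈ g′ i) →
                     (f ⊛ g) n ≈ (f′ ⊛ g′) n
    ⊛-coeff-cong-≤ n f≈f′ g≈g′ =
      ∑-cong-< (suc n) (λ i i<1+n → *-cong (f≈f′ i (ℕₚ.≤-pred i<1+n)) (g≈g′ (n ∸ i) (ℕₚ.m∸n≤m n i)))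

  powerSeriesSemiring : CommutativeSemiring c ℓ
  powerSeriesSemiring = record
    { Carrier = Seq ; _≈_ = _≋_ ; _+_ = _⊕_ ; _*_ = _⊛_ ; 0# = 𝟘 ; 1# = 𝟙
    ; isCommutativeSemiring = Biased.IsCommutativeSemiringˡ.isCommutativeSemiring record
      { +-isCommutativeMonoid = Biased.isCommutativeMonoidˡ record
        { isSemigroup = record
          { isMagma = record { isEquivalence = ≋-isEquivalence ; ∙-cong = ⊕-cong } ; assoc = ⊕-assoc }
        ; identityˡ = ⊕-identityˡ
        ; comm = ⊕-comm }
      ; *-isCommutativeMonoid = Biased.isCommutativeMonoidˡ record
        { isSemigroup = record
          { isMagma = record { isEquivalence = ≋-isEquivalence ; ∙-cong = ⊛-cong } ; assoc = ⊛-assoc }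
        ; identityˡ = ⊛-identityˡ
        ; comm = ⊛-comm }
      ; distribʳ = ⊛-distribʳ
      ; zeroˡ = ⊛-zeroˡ
      }
    }

  open RawSemiringDefinitions (CommutativeSemiring.rawSemiring powerSeriesSemiring) public using (_^_)

  ^-coeff-below : ∀ G → G 0 ≈ 0# → ∀ k n → n < k → (G ^ k) n ≈ 0#
  ^-coeff-below G G₀≈0 (suc k) n (s≤s n≤k) = begin
    (G ⊛ G ^ k) n                                                ≡⟨ ⊛-coeff G (G ^ k) n ⟩
    ∑ (suc n) (λ i → G i * (G ^ k) (n ∸ i))                       ≈⟨ ∑-unfoldˡ n _ ⟩
    G 0 * (G ^ k) n + ∑ n (λ i → G (suc i) * (G ^ k) (n ∸ suc i)) ≈⟨ +-cong head tail ⟩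
    0# + 0#                                                      ≈⟨ +-identityˡ _ ⟩
    0#                                                           ∎
    where
    head : G 0 * (G ^ k) n ≈ 0#
    head = trans (*-congʳ G₀≈0) (zeroˡ _)
    tail : ∑ n (λ i → G (suc i) * (G ^ k) (n ∸ suc i)) ≈ 0#
    tail = ∑-zero n (λ i i<n → trans (*-congˡ (^-coeff-below G G₀≈0 k (n ∸ suc i)
                                  (ℕₚ.<-≤-trans (ℕₚ.∸-monoʳ-< (s≤s z≤n) i<n) n≤k))) (zeroʳ _))

  geometric : Seq → Seq
  geometric G n = ∑ (suc n) (λ k → (G ^ k) n)

  geometric-unfold : ∀ G → G 0 ≈ 0# → geometric G ≋ 𝟙 ⊕ G ⊛ geometric G
  geometric-unfold G G₀≈0 n = begin
    ∑ (suc n) (λ k → (G ^ k) n)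
      ≈⟨ ∑-unfoldˡ n _ ⟩
    𝟙 n + ∑ n (λ k → (G ^ suc k) n)
      ≈⟨ +-congˡ (sym (∑-pad (suc n) (ℕₚ.n≤1+n n) (λ k n≤k _ → ^-coeff-below G G₀≈0 (suc k) n (s≤s n≤k)))) ⟩
    𝟙 n + ∑ (suc n) (λ k → (G ⊛ G ^ k) n)
      ≈⟨ +-congˡ (∑-cong (suc n) (λ k → reflexive (⊛-coeff G (G ^ k) n))) ⟩
    𝟙 n + ∑ (suc n) (λ k → ∑ (suc n) (λ i → G i * (G ^ k) (n ∸ i)))
      ≈⟨ +-congˡ (∑-swap (suc n) (suc n) _) ⟩
    𝟙 n + ∑ (suc n) (λ i → ∑ (suc n) (λ k → G i * (G ^ k) (n ∸ i)))
      ≈⟨ +-congˡ (∑-cong-< (suc n) factor) ⟩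
    𝟙 n + ∑ (suc n) (λ i → G i * geometric G (n ∸ i))
      ≈⟨ sym (trans (reflexive (⊕-coeff _ _ n)) (+-congˡ (reflexive (⊛-coeff G (geometric G) n)))) ⟩
    (𝟙 ⊕ G ⊛ geometric G) n ∎
    where
    factor : ∀ i → i < suc n → ∑ (suc n) (λ k → G i * (G ^ k) (n ∸ i)) ≈ G i * geometric G (n ∸ i)
    factor i (s≤s i≤n) = trans (sym (∑-distribˡ (suc n) _ _))
      (*-congˡ (∑-pad (suc n) (s≤s (ℕₚ.m∸n≤m n i)) (λ k n∸i<k _ → ^-coeff-below G G₀≈0 k (n ∸ i) n∸i<k)))

  _·t : Carrier → Seq
  (a ·t) 1 = a
  (a ·t) _ = 0#

  ·t⊛-coeff-zero : ∀ a F → ((a ·t) ⊛ F) 0 ≈ 0#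
  ·t⊛-coeff-zero a F = begin
    ((a ·t) ⊛ F) 0   ≡⟨ ⊛-coeff _ _ 0 ⟩
    0# + 0# * F 0    ≈⟨ +-identityˡ _ ⟩
    0# * F 0         ≈⟨ zeroˡ _ ⟩
    0#               ∎

  ·t⊛-coeff-suc : ∀ a F m → ((a ·t) ⊛ F) (suc m) ≈ a * F m
  ·t⊛-coeff-suc a F m = begin
    ((a ·t) ⊛ F) (suc m)
      ≡⟨ ⊛-coeff _ _ (suc m) ⟩
    ∑ (suc (suc m)) (λ i → (a ·t) i * F (suc m ∸ i))
      ≈⟨ trans (∑-unfoldˡ (suc m) _) (+-cong (zeroˡ _) (∑-unfoldˡ m _)) ⟩
    0# + (a * F m + ∑ m (λ i → 0# * F (m ∸ suc i)))
      ≈⟨ trans (+-identityˡ _) (+-congˡ (∑-zero m (λ _ _ → zeroˡ _))) ⟩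
    a * F m + 0#
      ≈⟨ +-identityʳ _ ⟩
    a * F m ∎

  𝟙⊕·t⊛-coeff-zero : ∀ a F → (𝟙 ⊕ (a ·t) ⊛ F) 0 ≈ 1#
  𝟙⊕·t⊛-coeff-zero a F =
    trans (reflexive (⊕-coeff _ _ 0)) (trans (+-cong (reflexive 𝟙-coeff-zero) (·t⊛-coeff-zero a F)) (+-identityʳ _))

  𝟙⊕·t⊛-coeff-suc : ∀ a F m → (𝟙 ⊕ (a ·t) ⊛ F) (suc m) ≈ a * F m
  𝟙⊕·t⊛-coeff-suc a F m = trans (reflexive (⊕-coeff _ _ (suc m)))
    (trans (+-cong (reflexive (𝟙-coeff-suc m)) (·t⊛-coeff-suc a F m)) (+-identityˡ _))

-- Opened only after the two modules above, whose semiring _+_ and _*_ would clash with ℕ's.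
open import Data.Nat using (_+_; _*_)
open import Algebra.Properties.CommutativeSemigroup ℕₚ.+-commutativeSemigroup
  using () renaming (x∙yz≈y∙xz to +-x∙yz≈y∙xz; interchange to +-interchange)

PolySemiring : CommutativeSemiring _ _
PolySemiring = PowerSeries.powerSeriesSemiring ℕₚ.+-*-commutativeSemiring

SeriesSemiring : CommutativeSemiring _ _
SeriesSemiring = PowerSeries.powerSeriesSemiring PolySemiring

module P = CommutativeSemiring PolySemiring
module S = CommutativeSemiring SeriesSemiring
module PolyCoeff = PowerSeries ℕₚ.+-*-commutativeSemiring
module SeriesCoeff = PowerSeries PolySemiring
module ∑ℕ = FiniteSum ℕₚ.+-*-commutativeSemiring
module ∑ᴾ = FiniteSum PolySemiring
module SeriesSolver = NaturalCoefficientsSolver SeriesSemiring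
open SeriesCoeff
  using (_^_; geometric; geometric-unfold; _·t; ·t⊛-coeff-zero; ·t⊛-coeff-suc; 𝟙⊕·t⊛-coeff-zero; 𝟙⊕·t⊛-coeff-suc)

sumℕ≡∑ : ∀ n f → sumℕ n f ≡ ∑ℕ.∑ n f
sumℕ≡∑ zero    f = refl
sumℕ≡∑ (suc n) f = ≡.cong (ℕ._+ f n) (sumℕ≡∑ n f)

pzero≈0 : pzero P.≈ P.0#
pzero≈0 k = ≡.sym (PolyCoeff.𝟘-coeff k)

pone≈1 : pone P.≈ P.1#
pone≈1 zero    = ≡.sym PolyCoeff.𝟙-coeff-zero
pone≈1 (suc k) = ≡.sym (PolyCoeff.𝟙-coeff-suc k)

padd≈+ : ∀ p r → padd p r P.≈ p P.+ r
padd≈+ p r k = ≡.sym (PolyCoeff.⊕-coeff p r k)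

pmul≈* : ∀ p r → pmul p r P.≈ p P.* r
pmul≈* p r k = ≡.trans (sumℕ≡∑ (suc k) _) (≡.sym (PolyCoeff.⊛-coeff p r k))

psum≈∑ : ∀ n f → psum n f P.≈ ∑ᴾ.∑ n f
psum≈∑ zero    f = pzero≈0
psum≈∑ (suc n) f k = ≡.trans (≡.cong (ℕ._+ f n k) (psum≈∑ n f k)) (≡.sym (PolyCoeff.⊕-coeff _ _ k))

sone≈1 : sone S.≈ S.1#
sone≈1 zero    = P.trans pone≈1 (P.reflexive (≡.sym SeriesCoeff.𝟙-coeff-zero))
sone≈1 (suc n) = P.trans pzero≈0 (P.reflexive (≡.sym (SeriesCoeff.𝟙-coeff-suc n)))

smul≈* : ∀ A B → smul A B S.≈ A S.* B
smul≈* A B n = P.trans (psum≈∑ (suc n) _)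
  (P.trans (∑ᴾ.∑-cong (suc n) (λ i → pmul≈* (A i) (B (n ∸ i)))) (P.reflexive (≡.sym (SeriesCoeff.⊛-coeff A B n))))

spow≈^ : ∀ G k → spow G k S.≈ G ^ k
spow≈^ G zero    = sone≈1
spow≈^ G (suc k) = S.trans (smul≈* G (spow G k)) (S.*-congˡ (spow≈^ G k))

inv1m≈geometric : ∀ G → inv1m G S.≈ geometric G
inv1m≈geometric G n = P.trans (psum≈∑ (suc n) _) (∑ᴾ.∑-cong (suc n) (λ k → spow≈^ G k n))

-- The S-fraction and its even contraction

tmul≈·t⊛ : ∀ j F → tmul j F S.≈ (α j ·t) S.* F
tmul≈·t⊛ j F zero    = P.trans pzero≈0 (P.sym (·t⊛-coeff-zero (α j) F))
tmul≈·t⊛ j F (suc n) = P.trans (pmul≈* (α j) (F n)) (P.sym (·t⊛-coeff-suc (α j) F n))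

cf-unfold : ∀ d j → cf (suc d) j S.≈ S.1# S.+ (α j ·t) S.* (cf d (suc j) S.* cf (suc d) j)
cf-unfold d j = begin
  inv1m G                                          ≈⟨ inv1m≈geometric G ⟩
  geometric G                                      ≈⟨ geometric-unfold G G₀≈0 ⟩
  S.1# S.+ G S.* geometric G                       ≈⟨ S.+-congˡ (S.*-cong (tmul≈·t⊛ j _) (S.sym (inv1m≈geometric G))) ⟩
  S.1# S.+ ((α j ·t) S.* cf d (suc j)) S.* inv1m G ≈⟨ S.+-congˡ (S.*-assoc _ _ _) ⟩
  S.1# S.+ (α j ·t) S.* (cf d (suc j) S.* inv1m G) ∎
  where
  open SetoidReasoning S.setoid
  G = tmul j (cf d (suc j))
  G₀≈0 : G 0 P.≈ P.0#
  G₀≈0 = P.trans (tmul≈·t⊛ j _ 0) (·t⊛-coeff-zero (α j) (cf d (suc j)))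

cf-coeff-zero : ∀ d j → cf d j 0 P.≈ P.1#
cf-coeff-zero zero    j = P.trans (sone≈1 0) (P.reflexive SeriesCoeff.𝟙-coeff-zero)
cf-coeff-zero (suc d) j = P.trans (cf-unfold d j 0) (𝟙⊕·t⊛-coeff-zero _ _)

cf-coeff-suc : ∀ d j m → cf (suc d) j (suc m) P.≈ α j P.* (cf d (suc j) S.* cf (suc d) j) m
cf-coeff-suc d j m = P.trans (cf-unfold d j (suc m)) (𝟙⊕·t⊛-coeff-suc _ _ m)

cf-agree : ∀ n d d′ j → n ≤ d → n ≤ d′ → ∀ i → i ≤ n → cf d j i P.≈ cf d′ j i
cf-agree n d d′ j n≤d n≤d′ zero _ = P.trans (cf-coeff-zero d j) (P.sym (cf-coeff-zero d′ j))
cf-agree (suc n) (suc d) (suc d′) j (s≤s n≤d) (s≤s n≤d′) (suc i) (s≤s i≤n) with ℕₚ.m≤n⇒m<n∨m≡n i≤n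
... | inj₁ i<n = cf-agree n (suc d) (suc d′) j (ℕₚ.m≤n⇒m≤1+n n≤d) (ℕₚ.m≤n⇒m≤1+n n≤d′) (suc i) i<n
... | inj₂ refl = P.trans (cf-coeff-suc d j i) (P.trans (P.*-congˡ (SeriesCoeff.⊛-coeff-cong-≤ i
        (cf-agree i d d′ (suc j) n≤d n≤d′)
        (cf-agree i (suc d) (suc d′) j (ℕₚ.m≤n⇒m≤1+n n≤d) (ℕₚ.m≤n⇒m≤1+n n≤d′))))
      (P.sym (cf-coeff-suc d′ j i)))

-- The continued fraction itself: its coefficient of t^n is that of the depth-n convergent.
cfLimit : ℕ → Series
cfLimit j n = cf n j n

cf-stable : ∀ d j n → n ≤ d → cf d j n P.≈ cfLimit j n
cf-stable d j n n≤d = cf-agree n d n j n≤d ℕₚ.≤-refl n ℕₚ.≤-refl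

cfLimit-unfold : ∀ j → cfLimit j S.≈ S.1# S.+ (α j ·t) S.* (cfLimit (suc j) S.* cfLimit j)
cfLimit-unfold j zero    = P.trans (cf-coeff-zero 0 j) (P.sym (𝟙⊕·t⊛-coeff-zero _ _))
cfLimit-unfold j (suc m) = P.trans (cf-coeff-suc m j m) (P.trans (P.*-congˡ (SeriesCoeff.⊛-coeff-cong-≤ m
    (λ i i≤m → cf-stable m (suc j) i i≤m)
    (λ i i≤m → cf-stable (suc m) j i (ℕₚ.m≤n⇒m≤1+n i≤m))))
  (P.sym (𝟙⊕·t⊛-coeff-suc _ _ m)))

α-odd : ∀ h → α (suc (h ℕ.+ h)) ≡ qint (suc h)
α-odd h = ≡.cong (λ k → qint (suc k)) (≡.sym (ℕₚ.n≡⌊n+n/2⌋ h))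

α-even : ∀ h → α (suc (suc (h ℕ.+ h))) ≡ qint (suc h)
α-even h = ≡.cong (λ k → qint (suc k)) (≡.sym (ℕₚ.n≡⌈n+n/2⌉ h))

oddLimit evenLimit : ℕ → Series
oddLimit  h = cfLimit (suc (h ℕ.+ h))
evenLimit h = cfLimit (suc (suc (h ℕ.+ h)))

oddLimit-unfold : ∀ h → oddLimit h S.≈ S.1# S.+ (qint (suc h) ·t) S.* (evenLimit h S.* oddLimit h)
oddLimit-unfold h = S.trans (cfLimit-unfold (suc (h ℕ.+ h)))
  (S.+-congˡ (S.*-congʳ (λ n → P.reflexive (≡.cong (λ a → (a ·t) n) (α-odd h)))))

evenLimit-unfold : ∀ h → evenLimit h S.≈ S.1# S.+ (qint (suc h) ·t) S.* (oddLimit (suc h) S.* evenLimit h)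
evenLimit-unfold h = S.trans (cfLimit-unfold (suc (suc (h ℕ.+ h))))
  (S.+-congˡ (S.*-cong (λ n → P.reflexive (≡.cong (λ a → (a ·t) n) (α-even h))) (S.*-congʳ next-odd)))
  where
  next-odd : cfLimit (suc (suc (suc (h ℕ.+ h)))) S.≈ oddLimit (suc h)
  next-odd n = P.reflexive (≡.cong (λ j → cfLimit (suc (suc j)) n) (≡.sym (ℕₚ.+-suc h h)))

Φ : ℕ → Series
Φ h = (qint (suc h) ·t) S.* (evenLimit h S.* oddLimit h)

Φ-recurrence : ∀ h → Φ h S.≈ (qint (suc h) ·t) S.* ((S.1# S.+ Φ h) S.+ Φ h S.+ Φ (suc h) S.* Φ h)
Φ-recurrence h = S.*-congˡ (begin
  v S.* u                                          ≈⟨ S.*-congʳ (evenLimit-unfold h) ⟩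
  (S.1# S.+ A S.* (u′ S.* v)) S.* u                ≈⟨ expand A u′ v u ⟩
  u S.+ u′ S.* Φ h                                 ≈⟨ S.+-cong (oddLimit-unfold h) (S.*-congʳ (oddLimit-unfold (suc h))) ⟩
  (S.1# S.+ Φ h) S.+ (S.1# S.+ Φ (suc h)) S.* Φ h  ≈⟨ regroup (Φ h) (Φ (suc h)) ⟩
  (S.1# S.+ Φ h) S.+ Φ h S.+ Φ (suc h) S.* Φ h     ∎)
  where
  open SetoidReasoning S.setoid
  open SeriesSolver
  A = qint (suc h) ·t
  u = oddLimit h
  u′ = oddLimit (suc h)
  v = evenLimit h
  expand : ∀ A u′ v u → (S.1# S.+ A S.* (u′ S.* v)) S.* u S.≈ u S.+ u′ S.* (A S.* (v S.* u))
  expand = solve 4 (λ A u′ v u → (con 1 :+ A :* (u′ :* v)) :* u := u :+ u′ :* (A :* (v :* u))) S.refl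
  regroup : ∀ F F′ → (S.1# S.+ F) S.+ (S.1# S.+ F′) S.* F S.≈ (S.1# S.+ F) S.+ F S.+ F′ S.* F
  regroup = solve 2 (λ F F′ → (con 1 :+ F) :+ (con 1 :+ F′) :* F := (con 1 :+ F) :+ F :+ F′ :* F) S.refl

Π : ℕ → Series
Π zero    = S.1#
Π (suc x) = Φ x S.* Π x

Π-recurrence : ∀ x → Π (suc x) S.≈ (qint (suc x) ·t) S.* (Π x S.+ Π (suc x) S.+ Π (suc x) S.+ Π (suc (suc x)))
Π-recurrence x = begin
  Φ x S.* Π x
    ≈⟨ S.*-congʳ (Φ-recurrence x) ⟩
  (A S.* ((S.1# S.+ Φ x) S.+ Φ x S.+ Φ (suc x) S.* Φ x)) S.* Π x
    ≈⟨ distribute A (Φ x) (Φ (suc x)) (Π x) ⟩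
  A S.* (Π x S.+ Π (suc x) S.+ Π (suc x) S.+ Π (suc (suc x))) ∎
  where
  open SetoidReasoning S.setoid
  open SeriesSolver
  A = qint (suc x) ·t
  distribute : ∀ A F F′ Q → (A S.* ((S.1# S.+ F) S.+ F S.+ F′ S.* F)) S.* Q S.≈
                            A S.* (Q S.+ F S.* Q S.+ F S.* Q S.+ F′ S.* (F S.* Q))
  distribute = solve 4 (λ A F F′ Q → (A :* ((con 1 :+ F) :+ F :+ F′ :* F)) :* Q :=
                                      A :* (Q :+ F :* Q :+ F :* Q :+ F′ :* (F :* Q))) S.refl

-- Weighted Motzkin paths of length r from height x down to 0, positive before the last step:
-- a step leaving height h weighs [h]_q, and level steps come in two colours.
pathPoly : ℕ → ℕ → Poly
pathPoly zero    zero    = pone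
pathPoly zero    (suc _) = pzero
pathPoly (suc r) zero    = pzero
pathPoly (suc r) (suc x) =
  pmul (qint (suc x)) (padd (padd (padd (pathPoly r x) (pathPoly r (suc x))) (pathPoly r (suc x)))
                            (pathPoly r (suc (suc x))))

pathPoly≈Π : ∀ r x → pathPoly r x P.≈ Π x r
pathPoly≈Π zero    zero    = P.trans pone≈1 (P.reflexive (≡.sym SeriesCoeff.𝟙-coeff-zero))
pathPoly≈Π zero    (suc x) = P.trans pzero≈0 (P.sym (P.trans (Π-recurrence x 0) (·t⊛-coeff-zero _ _)))
pathPoly≈Π (suc r) zero    = P.trans pzero≈0 (P.reflexive (≡.sym (SeriesCoeff.𝟙-coeff-suc r)))
pathPoly≈Π (suc r) (suc x) = begin
  pathPoly (suc r) (suc x)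
    ≈⟨ P.trans (pmul≈* _ _)
               (P.*-congˡ (P.trans (padd≈+ _ _) (P.+-congʳ (P.trans (padd≈+ _ _) (P.+-congʳ (padd≈+ _ _)))))) ⟩
  qint (suc x) P.* (pathPoly r x P.+ pathPoly r (suc x) P.+ pathPoly r (suc x) P.+ pathPoly r (suc (suc x)))
    ≈⟨ P.*-congˡ (P.+-cong (P.+-cong (P.+-cong (pathPoly≈Π r x) (pathPoly≈Π r (suc x))) (pathPoly≈Π r (suc x)))
                           (pathPoly≈Π r (suc (suc x)))) ⟩
  qint (suc x) P.* (Π x r P.+ Π (suc x) r P.+ Π (suc x) r P.+ Π (suc (suc x)) r)
    ≈⟨ P.*-congˡ (P.sym (P.trans (⊕ r) (P.+-congʳ (P.trans (⊕ r) (P.+-congʳ (⊕ r)))))) ⟩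
  qint (suc x) P.* (Π x S.+ Π (suc x) S.+ Π (suc x) S.+ Π (suc (suc x))) r
    ≈⟨ P.sym (P.trans (Π-recurrence x (suc r)) (·t⊛-coeff-suc _ _ r)) ⟩
  Π (suc x) (suc r) ∎
  where
  open SetoidReasoning P.setoid
  ⊕ : ∀ r {A B} → (A S.+ B) r P.≈ A r P.+ B r
  ⊕ r = P.reflexive (SeriesCoeff.⊕-coeff _ _ r)

cf≈pathPoly : ∀ n d → 1 ≤ n → n ≤ d → cf d 1 n P.≈ pathPoly n 1
cf≈pathPoly (suc m) d _ n≤d = begin
  cf d 1 (suc m)                      ≈⟨ cf-stable d 1 (suc m) n≤d ⟩
  oddLimit 0 (suc m)                  ≈⟨ oddLimit-unfold 0 (suc m) ⟩
  (S.1# S.+ Φ 0) (suc m)              ≡⟨ SeriesCoeff.⊕-coeff _ _ (suc m) ⟩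
  S.1# (suc m) P.+ Φ 0 (suc m)        ≈⟨ P.+-congʳ (P.reflexive (SeriesCoeff.𝟙-coeff-suc m)) ⟩
  P.0# P.+ Φ 0 (suc m)                ≈⟨ P.+-identityˡ _ ⟩
  Φ 0 (suc m)                         ≈⟨ S.sym (S.*-identityʳ (Φ 0)) (suc m) ⟩
  Π 1 (suc m)                         ≈⟨ P.sym (pathPoly≈Π (suc m) 1) ⟩
  pathPoly (suc m) 1                  ∎
  where open SetoidReasoning P.setoid

module _ {p} {A : Set p} {b : Bool} (r : Reflects A b) where

  reflects-true : A → b ≡ true
  reflects-true a = Reflects.det r (ofʸ a)

  reflects-false : ¬ A → b ≡ false
  reflects-false ¬a = Reflects.det r (ofⁿ ¬a)

  reflects-sound : b ≡ true → A
  reflects-sound refl = Reflects.invert r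

  reflects-refute : b ≡ false → ¬ A
  reflects-refute refl = Reflects.invert r

reflects-≡ : ∀ {p q} {A : Set p} {B : Set q} {a b} → Reflects A a → Reflects B b → (A → B) → (B → A) → a ≡ b
reflects-≡ (ofʸ _)  (ofʸ _)  _  _    = refl
reflects-≡ (ofⁿ _)  (ofⁿ _)  _  _    = refl
reflects-≡ (ofʸ a)  (ofⁿ ¬b) to _    with () ← ¬b (to a)
reflects-≡ (ofⁿ ¬a) (ofʸ b)  _  from with () ← ¬a (from b)

does-sound : ∀ {p} {A : Set p} (a? : Dec A) → does a? ≡ true → A
does-sound a? = reflects-sound (proof a?)

<ᵇ-true : ∀ {m n} → m < n → (m <ᵇ n) ≡ true
<ᵇ-true = reflects-true (ℕₚ.<ᵇ-reflects-< _ _)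

<ᵇ-false : ∀ {m n} → n ≤ m → (m <ᵇ n) ≡ false
<ᵇ-false n≤m = reflects-false (ℕₚ.<ᵇ-reflects-< _ _) (ℕₚ.≤⇒≯ n≤m)

<ᵇ-sound : ∀ {m n} → (m <ᵇ n) ≡ true → m < n
<ᵇ-sound = reflects-sound (ℕₚ.<ᵇ-reflects-< _ _)

≤ᵇ-true : ∀ {m n} → m ≤ n → (m ≤ᵇ n) ≡ true
≤ᵇ-true = reflects-true (ℕₚ.≤ᵇ-reflects-≤ _ _)

≤ᵇ-false : ∀ {m n} → n < m → (m ≤ᵇ n) ≡ false
≤ᵇ-false n<m = reflects-false (ℕₚ.≤ᵇ-reflects-≤ _ _) (ℕₚ.<⇒≱ n<m)

≤ᵇ-sound : ∀ {m n} → (m ≤ᵇ n) ≡ true → m ≤ n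
≤ᵇ-sound = reflects-sound (ℕₚ.≤ᵇ-reflects-≤ _ _)

≤ᵇ-false-sound : ∀ {m n} → (m ≤ᵇ n) ≡ false → n < m
≤ᵇ-false-sound m≰ᵇn = ℕₚ.≰⇒> (reflects-refute (ℕₚ.≤ᵇ-reflects-≤ _ _) m≰ᵇn)

≡ᵇ-reflects-≡ : ∀ m n → Reflects (m ≡ n) (m ≡ᵇ n)
≡ᵇ-reflects-≡ m n = Reflects.fromEquivalence (ℕₚ.≡ᵇ⇒≡ m n) (ℕₚ.≡⇒≡ᵇ m n)

≡ᵇ-refl : ∀ n → (n ≡ᵇ n) ≡ true
≡ᵇ-refl n = reflects-true (≡ᵇ-reflects-≡ n n) refl

≡ᵇ-false : ∀ {m n} → m ≢ n → (m ≡ᵇ n) ≡ false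
≡ᵇ-false = reflects-false (≡ᵇ-reflects-≡ _ _)

≡ᵇ-sound : ∀ {m n} → (m ≡ᵇ n) ≡ true → m ≡ n
≡ᵇ-sound = reflects-sound (≡ᵇ-reflects-≡ _ _)

⟦_⟧ : Bool → ℕ
⟦ b ⟧ = if b then 1 else 0

module _ {A : Set} where

  length-filterᵇ-cons : ∀ (p : A → Bool) x xs → length (filterᵇ p (x ∷ xs)) ≡ ⟦ p x ⟧ + length (filterᵇ p xs)
  length-filterᵇ-cons p x xs with p x
  ... | true  = refl
  ... | false = refl

  length-filterᵇ-++ : ∀ (p : A → Bool) xs ys →
                      length (filterᵇ p (xs ++ ys)) ≡ length (filterᵇ p xs) + length (filterᵇ p ys)
  length-filterᵇ-++ p xs ys = ≡.trans (cong length (Listₚ.filter-++ (T? ∘ p) xs ys)) (Listₚ.length-++ (filterᵇ p xs))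

  length-filterᵇ-split : ∀ {p q r : A → Bool} → (∀ x → ⟦ p x ⟧ ≡ ⟦ q x ⟧ + ⟦ r x ⟧) → ∀ xs →
                         length (filterᵇ p xs) ≡ length (filterᵇ q xs) + length (filterᵇ r xs)
  length-filterᵇ-split split []       = refl
  length-filterᵇ-split {p} {q} {r} split (x ∷ xs) = begin
    length (filterᵇ p (x ∷ xs))
      ≡⟨ length-filterᵇ-cons p x xs ⟩
    ⟦ p x ⟧ + length (filterᵇ p xs)
      ≡⟨ cong₂ _+_ (split x) (length-filterᵇ-split split xs) ⟩
    (⟦ q x ⟧ + ⟦ r x ⟧) + (length (filterᵇ q xs) + length (filterᵇ r xs))
      ≡⟨ +-interchange ⟦ q x ⟧ ⟦ r x ⟧ _ _ ⟩
    (⟦ q x ⟧ + length (filterᵇ q xs)) + (⟦ r x ⟧ + length (filterᵇ r xs))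
      ≡⟨ cong₂ _+_ (≡.sym (length-filterᵇ-cons q x xs)) (≡.sym (length-filterᵇ-cons r x xs)) ⟩
    length (filterᵇ q (x ∷ xs)) + length (filterᵇ r (x ∷ xs)) ∎
    where open ≡.≡-Reasoning

  filterᵇ-≗ : ∀ {p q : A → Bool} → (∀ x → p x ≡ q x) → ∀ xs → filterᵇ p xs ≡ filterᵇ q xs
  filterᵇ-≗ {p} {q} p≗q =
    Listₚ.filter-≐ (T? ∘ p) (T? ∘ q) ((λ {x} → ≡.subst T (p≗q x)) , (λ {x} → ≡.subst T (≡.sym (p≗q x))))

  filterᵇ-cong : ∀ {p q : A → Bool} xs → All (λ x → p x ≡ q x) xs → filterᵇ p xs ≡ filterᵇ q xs
  filterᵇ-cong []       []             = refl
  filterᵇ-cong {p} {q} (x ∷ xs) (px≡qx ∷ rest) with p x | q x | px≡qx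
  ... | true  | .true  | refl = cong (x ∷_) (filterᵇ-cong xs rest)
  ... | false | .false | refl = filterᵇ-cong xs rest

  filterᵇ-satisfied : ∀ (p : A → Bool) xs → All (λ x → p x ≡ true) (filterᵇ p xs)
  filterᵇ-satisfied p xs = All.map (Equivalence.to T-≡) (Allₚ.all-filter (T? ∘ p) xs)

  filterᵇ-All : ∀ {P : A → Set} (p : A → Bool) {xs} → All P xs → All (λ x → P x × p x ≡ true) (filterᵇ p xs)
  filterᵇ-All p {xs} Pxs = All.zip (Allₚ.filter⁺ (T? ∘ p) Pxs , filterᵇ-satisfied p xs)

  filterᵇ-none : ∀ (p : A → Bool) xs → All (λ x → p x ≡ false) xs → filterᵇ p xs ≡ []
  filterᵇ-none p xs = Listₚ.filter-none (T? ∘ p) ∘ All.map (λ px≡false → ≡.subst T px≡false)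

  filterᵇ-all : ∀ (p : A → Bool) {xs} → All (λ x → p x ≡ true) xs → filterᵇ p xs ≡ xs
  filterᵇ-all p = Listₚ.filter-all (T? ∘ p) ∘ All.map (λ px≡true → ≡.subst T (≡.sym px≡true) _)

  filterᵇ-comm : ∀ (p q : A → Bool) xs → filterᵇ p (filterᵇ q xs) ≡ filterᵇ q (filterᵇ p xs)
  filterᵇ-comm p q []       = refl
  filterᵇ-comm p q (x ∷ xs) with q x in qx | p x in px
  ... | true  | true  rewrite qx | px = cong (x ∷_) (filterᵇ-comm p q xs)
  ... | true  | false rewrite px      = filterᵇ-comm p q xs
  ... | false | true  rewrite qx      = filterᵇ-comm p q xs
  ... | false | false                 = filterᵇ-comm p q xs

  filterᵇ-concat : ∀ (p : A → Bool) xss → filterᵇ p (concat xss) ≡ concatMap (filterᵇ p) xss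
  filterᵇ-concat p []         = refl
  filterᵇ-concat p (xs ∷ xss) =
    ≡.trans (Listₚ.filter-++ (T? ∘ p) xs (concat xss)) (cong (filterᵇ p xs ++_) (filterᵇ-concat p xss))

  filterᵇ-map : ∀ {B : Set} (p : B → Bool) (f : A → B) xs → filterᵇ p (map f xs) ≡ map f (filterᵇ (p ∘ f) xs)
  filterᵇ-map p f []       = refl
  filterᵇ-map p f (x ∷ xs) with p (f x)
  ... | true  = cong (f x ∷_) (filterᵇ-map p f xs)
  ... | false = filterᵇ-map p f xs

  length-filterᵇ-map : ∀ {B : Set} (p : B → Bool) (f : A → B) xs →
                       length (filterᵇ p (map f xs)) ≡ length (filterᵇ (p ∘ f) xs)
  length-filterᵇ-map p f xs = ≡.trans (cong length (filterᵇ-map p f xs)) (Listₚ.length-map f (filterᵇ (p ∘ f) xs))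

module _ {A C : Set} where

  concatMap-↭ : ∀ {F G : C → List A} {cs} → All (λ c → F c ↭ G c) cs → concatMap F cs ↭ concatMap G cs
  concatMap-↭ []           = ↭-refl
  concatMap-↭ (F↭G ∷ rest) = ↭ₚ.++⁺ F↭G (concatMap-↭ rest)

module Multiplicity {A : Set} (eq : A → A → Bool) (eq-reflects : ∀ a b → Reflects (a ≡ b) (eq a b)) where

  multiplicity : A → List A → ℕ
  multiplicity a xs = length (filterᵇ (λ x → eq x a) xs)

  multiplicity-self : ∀ a xs → multiplicity a (a ∷ xs) ≡ suc (multiplicity a xs)
  multiplicity-self a xs rewrite reflects-true (eq-reflects a a) refl = refl

  multiplicity-split : ∀ x ys → 1 ≤ multiplicity x ys → ∃[ P ] ∃[ S ] ys ≡ P ++ x ∷ S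
  multiplicity-split x (y ∷ ys) 1≤mult with eq y x in y≟x
  ... | true = [] , ys , cong (_∷ ys) (reflects-sound (eq-reflects y x) y≟x)
  ... | false with multiplicity-split x ys 1≤mult
  ...   | P , S , ys≡P++x∷S = y ∷ P , S , cong (y ∷_) ys≡P++x∷S

  multiplicity-≗⇒↭ : ∀ xs ys → (∀ a → multiplicity a xs ≡ multiplicity a ys) → xs ↭ ys
  multiplicity-≗⇒↭ []       []       _    = ↭-refl
  multiplicity-≗⇒↭ []       (y ∷ ys) same with () ← ≡.trans (same y) (multiplicity-self y ys)
  multiplicity-≗⇒↭ (x ∷ xs) ys       same
    with multiplicity-split x ys (≡.subst (1 ≤_) (≡.trans (≡.sym (multiplicity-self x xs)) (same x)) (s≤s z≤n))
  ... | P , S , refl = ↭-trans (↭-prep x (multiplicity-≗⇒↭ xs (P ++ S) same′)) (↭-sym (↭ₚ.shift x P S))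
    where
    same′ : ∀ a → multiplicity a xs ≡ multiplicity a (P ++ S)
    same′ a = ℕₚ.+-cancelˡ-≡ ⟦ eq x a ⟧ _ _ (begin
      ⟦ eq x a ⟧ + multiplicity a xs
        ≡⟨ ≡.sym (length-filterᵇ-cons _ x xs) ⟩
      multiplicity a (x ∷ xs)
        ≡⟨ same a ⟩
      multiplicity a (P ++ x ∷ S)
        ≡⟨ length-filterᵇ-++ _ P (x ∷ S) ⟩
      multiplicity a P + multiplicity a (x ∷ S)
        ≡⟨ cong (multiplicity a P +_) (length-filterᵇ-cons _ x S) ⟩
      multiplicity a P + (⟦ eq x a ⟧ + multiplicity a S)
        ≡⟨ +-x∙yz≈y∙xz (multiplicity a P) ⟦ eq x a ⟧ (multiplicity a S) ⟩
      ⟦ eq x a ⟧ + (multiplicity a P + multiplicity a S)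
        ≡⟨ cong (⟦ eq x a ⟧ +_) (≡.sym (length-filterᵇ-++ _ P S)) ⟩
      ⟦ eq x a ⟧ + multiplicity a (P ++ S) ∎)
      where open ≡.≡-Reasoning

module _ {A C : Set} (Q : C → A → Bool) where

  memberships : List C → A → ℕ
  memberships []       x = 0
  memberships (c ∷ cs) x = ⟦ Q c x ⟧ + memberships cs x

  memberships-++ : ∀ cs cs′ x → memberships (cs ++ cs′) x ≡ memberships cs x + memberships cs′ x
  memberships-++ []       cs′ x = refl
  memberships-++ (c ∷ cs) cs′ x =
    ≡.trans (cong (⟦ Q c x ⟧ +_) (memberships-++ cs cs′ x)) (≡.sym (ℕₚ.+-assoc ⟦ Q c x ⟧ _ _))

  memberships-none : ∀ cs x → (∀ c → Q c x ≡ false) → memberships cs x ≡ 0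
  memberships-none []       x none = refl
  memberships-none (c ∷ cs) x none rewrite none c = memberships-none cs x none

  private
    classes : List C → List A → List A
    classes cs xs = concatMap (λ c → filterᵇ (Q c) xs) cs

    classes-[] : ∀ cs → classes cs [] ≡ []
    classes-[] []       = refl
    classes-[] (c ∷ cs) = classes-[] cs

    classes-skip : ∀ cs x xs → memberships cs x ≡ 0 → classes cs (x ∷ xs) ≡ classes cs xs
    classes-skip []       x xs _ = refl
    classes-skip (c ∷ cs) x xs none with Q c x
    ... | false = cong (filterᵇ (Q c) xs ++_) (classes-skip cs x xs none)

    classes-once : ∀ cs x xs → memberships cs x ≡ 1 → classes cs (x ∷ xs) ↭ x ∷ classes cs xs
    classes-once (c ∷ cs) x xs once with Q c x
    ... | true  = ↭-prep x (↭-reflexive (cong (filterᵇ (Q c) xs ++_) (classes-skip cs x xs (ℕₚ.suc-injective once))))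
    ... | false = ↭-trans (↭ₚ.++⁺ˡ (filterᵇ (Q c) xs) (classes-once cs x xs once)) (↭ₚ.shift x (filterᵇ (Q c) xs) _)

  filterᵇ-↭-partition : ∀ (P : A → Bool) cs xs → All (λ x → memberships cs x ≡ ⟦ P x ⟧) xs →
                        filterᵇ P xs ↭ concatMap (λ c → filterᵇ (Q c) xs) cs
  filterᵇ-↭-partition P cs []       []               = ↭-reflexive (≡.sym (classes-[] cs))
  filterᵇ-↭-partition P cs (x ∷ xs) (count-x ∷ rest) with P x
  ... | true  = ↭-sym (↭-trans (classes-once cs x xs count-x) (↭-prep x (↭-sym (filterᵇ-↭-partition P cs xs rest))))
  ... | false = ↭-trans (filterᵇ-↭-partition P cs xs rest) (↭-reflexive (≡.sym (classes-skip cs x xs count-x)))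

memberships-cong : ∀ {A C : Set} {Q Q′ : C → A → Bool} cs x → All (λ c → Q c x ≡ Q′ c x) cs →
                   memberships Q cs x ≡ memberships Q′ cs x
memberships-cong []       x []           = refl
memberships-cong (c ∷ cs) x (eq ∷ rest) = cong₂ _+_ (cong ⟦_⟧ eq) (memberships-cong cs x rest)

module ℕ-Multiplicity = Multiplicity _≡ᵇ_ ≡ᵇ-reflects-≡

countOcc-cons : ∀ v x xs → countOcc v (x ∷ xs) ≡ ⟦ x ≡ᵇ v ⟧ + countOcc v xs
countOcc-cons v = length-filterᵇ-cons (_≡ᵇ v)

countOcc-≢ : ∀ {v} x xs → (x ≡ᵇ v) ≡ false → countOcc v (x ∷ xs) ≡ countOcc v xs
countOcc-≢ {v} x xs x≢v = ≡.trans (countOcc-cons v x xs) (cong (λ b → ⟦ b ⟧ + countOcc v xs) x≢v)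

countOcc-self : ∀ v xs → countOcc v (v ∷ xs) ≡ suc (countOcc v xs)
countOcc-self = ℕ-Multiplicity.multiplicity-self

countOcc-++ : ∀ v xs ys → countOcc v (xs ++ ys) ≡ countOcc v xs + countOcc v ys
countOcc-++ v = length-filterᵇ-++ (_≡ᵇ v)

countOcc-cons-zero : ∀ {v} y R → countOcc v (y ∷ R) ≡ 0 → (y ≡ᵇ v) ≡ false × countOcc v R ≡ 0
countOcc-cons-zero {v} y R none with y ≡ᵇ v
... | false = refl , none

countOcc-↭ : ∀ k {xs ys} → xs ↭ ys → countOcc k xs ≡ countOcc k ys
countOcc-↭ k p = ↭ₚ.↭-length (↭ₚ.filter-↭ (T? ∘ (_≡ᵇ k)) p)

-- Blocks and insertion

Blocks : Set
Blocks = List (List ℕ)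

infix 4 _≟ᴸ_ _==ᴸ_
_≟ᴸ_ : DecidableEquality (List ℕ)
_≟ᴸ_ = Listₚ.≡-dec ℕₚ._≟_

_==ᴸ_ : List ℕ → List ℕ → Bool
xs ==ᴸ ys = does (xs ≟ᴸ ys)

infix 4 _≟ᴮ_ _==ᴮ_
_≟ᴮ_ : DecidableEquality Blocks
_≟ᴮ_ = Listₚ.≡-dec _≟ᴸ_

_==ᴮ_ : Blocks → Blocks → Bool
w ==ᴮ w′ = does (w ≟ᴮ w′)

data Slot : Set where
  fill attachˡ attachʳ alone : Slot

Choice : Set
Choice = ℕ × Slot

insertInGap : ℕ → Slot → List ℕ → List ℕ → Blocks → Blocks
insertInGap v fill    B B′ Bs = (B ++ v ∷ B′) ∷ Bs
insertInGap v attachˡ B B′ Bs = (B ++ [ v ]) ∷ B′ ∷ Bs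
insertInGap v attachʳ B B′ Bs = B ∷ (v ∷ B′) ∷ Bs
insertInGap v alone   B B′ Bs = B ∷ [ v ] ∷ B′ ∷ Bs

-- The gap g lies between the blocks g and g + 1.
insert : ℕ → Choice → Blocks → Blocks
insert v (zero  , s) (B ∷ B′ ∷ Bs) = insertInGap v s B B′ Bs
insert v (suc g , s) (B ∷ Bs)      = B ∷ insert v (g , s) Bs
insert v _           w             = w

blocksAfter : Slot → ℕ → ℕ
blocksAfter fill    b = b ∸ 1
blocksAfter attachˡ b = b
blocksAfter attachʳ b = b
blocksAfter alone   b = suc b

InRange : Choice → Blocks → Set
InRange c w = suc (proj₁ c) < length w

length-insert : ∀ v c w → InRange c w → length (insert v c w) ≡ blocksAfter (proj₂ c) (length w)
length-insert v (zero , _)       (B ∷ [])      (s≤s ())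
length-insert v (zero , fill)    (B ∷ B′ ∷ Bs) _ = refl
length-insert v (zero , attachˡ) (B ∷ B′ ∷ Bs) _ = refl
length-insert v (zero , attachʳ) (B ∷ B′ ∷ Bs) _ = refl
length-insert v (zero , alone)   (B ∷ B′ ∷ Bs) _ = refl
length-insert v (suc g , s) (B ∷ Bs) (s≤s in-range) =
  ≡.trans (cong suc (length-insert v (g , s) Bs in-range)) (blocksAfter-suc s (ℕₚ.≤-trans (s≤s z≤n) in-range))
  where
  blocksAfter-suc : ∀ s {b} → 1 ≤ b → suc (blocksAfter s b) ≡ blocksAfter s (suc b)
  blocksAfter-suc fill    (s≤s _) = refl
  blocksAfter-suc attachˡ _       = refl
  blocksAfter-suc attachʳ _       = refl
  blocksAfter-suc alone   _       = refl

splitAtValue : ℕ → List ℕ → Maybe (List ℕ × List ℕ)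
splitAtValue v []       = nothing
splitAtValue v (x ∷ xs) = if x ≡ᵇ v then just ([] , xs) else Maybe.map (Product.map₁ (x ∷_)) (splitAtValue v xs)

popLeading : ℕ → Blocks → Maybe (List ℕ × Blocks)
popLeading v ((y ∷ R) ∷ Bs) = if y ≡ᵇ v then just (R , Bs) else nothing
popLeading v _              = nothing

uninsertStep : List ℕ → Blocks → Maybe (List ℕ × List ℕ) → Maybe (List ℕ × Blocks) → Choice × Blocks → Choice × Blocks
uninsertStep B Bs (just (L , []))     _                    _             = (0 , attachˡ) , L ∷ Bs
uninsertStep B Bs (just (L , r ∷ R))  _                    _             = (0 , fill) , L ∷ (r ∷ R) ∷ Bs
uninsertStep B Bs nothing             (just ([] , Bs′))    _             = (0 , alone) , B ∷ Bs′
uninsertStep B Bs nothing             (just (r ∷ R , Bs′)) _             = (0 , attachʳ) , B ∷ (r ∷ R) ∷ Bs′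
uninsertStep B Bs nothing             nothing              ((g , s) , w) = (suc g , s) , B ∷ w

uninsert : ℕ → Blocks → Choice × Blocks
uninsert v []       = (0 , fill) , []
uninsert v (B ∷ Bs) = uninsertStep B Bs (splitAtValue v B) (popLeading v Bs) (uninsert v Bs)

NonEmpty : List ℕ → Set
NonEmpty []      = ⊥
NonEmpty (_ ∷ _) = ⊤

Avoids : ℕ → Blocks → Set
Avoids v w = All (λ B → NonEmpty B × countOcc v B ≡ 0) w

splitAtValue-absent : ∀ v B → countOcc v B ≡ 0 → splitAtValue v B ≡ nothing
splitAtValue-absent v []      _    = refl
splitAtValue-absent v (x ∷ B) none with countOcc-cons-zero x B none
... | x≢v , none′ rewrite x≢v | splitAtValue-absent v B none′ = refl

splitAtValue-first : ∀ v B B′ → countOcc v B ≡ 0 → splitAtValue v (B ++ v ∷ B′) ≡ just (B , B′)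
splitAtValue-first v []      B′ _ rewrite ≡ᵇ-refl v = refl
splitAtValue-first v (x ∷ B) B′ none with countOcc-cons-zero x B none
... | x≢v , none′ rewrite x≢v | splitAtValue-first v B B′ none′ = refl

popLeading-insert : ∀ v c b R Bs → (b ≡ᵇ v) ≡ false → popLeading v (insert v c ((b ∷ R) ∷ Bs)) ≡ nothing
popLeading-insert v (zero  , s)       b R []         b≢v rewrite b≢v = refl
popLeading-insert v (zero  , fill)    b R (B′ ∷ Bs) b≢v rewrite b≢v = refl
popLeading-insert v (zero  , attachˡ) b R (B′ ∷ Bs) b≢v rewrite b≢v = refl
popLeading-insert v (zero  , attachʳ) b R (B′ ∷ Bs) b≢v rewrite b≢v = refl
popLeading-insert v (zero  , alone)   b R (B′ ∷ Bs) b≢v rewrite b≢v = refl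
popLeading-insert v (suc g , s)       b R Bs         b≢v rewrite b≢v = refl

uninsert-insert : ∀ v c w → Avoids v w → InRange c w → uninsert v (insert v c w) ≡ (c , w)
uninsert-insert v (zero , _)       (B ∷ [])           _                  (s≤s ())
uninsert-insert v (zero , fill)    (B ∷ [] ∷ Bs)      (_ ∷ (() , _) ∷ _) _
uninsert-insert v (zero , attachʳ) (B ∷ [] ∷ Bs)      (_ ∷ (() , _) ∷ _) _
uninsert-insert v (zero , fill)    (B ∷ (r ∷ R) ∷ Bs) ((_ , B∌v) ∷ _) _
  rewrite splitAtValue-first v B (r ∷ R) B∌v = refl
uninsert-insert v (zero , attachˡ) (B ∷ B′ ∷ Bs)      ((_ , B∌v) ∷ _) _
  rewrite splitAtValue-first v B [] B∌v = refl
uninsert-insert v (zero , attachʳ) (B ∷ (r ∷ R) ∷ Bs) ((_ , B∌v) ∷ _) _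
  rewrite splitAtValue-absent v B B∌v | ≡ᵇ-refl v = refl
uninsert-insert v (zero , alone)   (B ∷ B′ ∷ Bs)      ((_ , B∌v) ∷ _) _
  rewrite splitAtValue-absent v B B∌v | ≡ᵇ-refl v = refl
uninsert-insert v (suc g , s) (B ∷ (b ∷ R) ∷ Bs) ((_ , B∌v) ∷ avoids@((_ , bR∌v) ∷ _)) (s≤s in-range)
  rewrite splitAtValue-absent v B B∌v
        | popLeading-insert v (g , s) b R Bs (proj₁ (countOcc-cons-zero b R bR∌v))
        | uninsert-insert v (g , s) ((b ∷ R) ∷ Bs) avoids in-range = refl

insert-injective : ∀ v {c c′ w w′} → Avoids v w → InRange c w → Avoids v w′ → InRange c′ w′ →
                   insert v c w ≡ insert v c′ w′ → c ≡ c′ × w ≡ w′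
insert-injective v {c} {c′} {w} {w′} avoids in-range avoids′ in-range′ same = ,-injective (begin
  c , w                    ≡⟨ ≡.sym (uninsert-insert v c w avoids in-range) ⟩
  uninsert v (insert v c w)     ≡⟨ cong (uninsert v) same ⟩
  uninsert v (insert v c′ w′)   ≡⟨ uninsert-insert v c′ w′ avoids′ in-range′ ⟩
  c′ , w′                  ∎)
  where open ≡.≡-Reasoning

mult : ℕ → ℕ → ℕ
mult m zero    = 0
mult m (suc u) = ⟦ u <ᵇ m ⟧

record IsPermutation (n : ℕ) (σ : List ℕ) : Set where
  constructor isPermutation
  field counts : ∀ u → countOcc u σ ≡ mult n u

open IsPermutation

WellFormed : ℕ → Blocks → Set
WellFormed m w = All NonEmpty w × ∃[ τ ] concat w ≡ 0 ∷ τ ++ [ 0 ] × IsPermutation m τ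

mult-suc : ∀ m u → mult (suc m) u ≡ ⟦ suc m ≡ᵇ u ⟧ + mult m u
mult-suc m zero    = refl
mult-suc m (suc u) with ℕₚ.<-cmp u m
... | tri< u<m u≢m _ rewrite <ᵇ-true (ℕₚ.m≤n⇒m≤1+n u<m) | <ᵇ-true u<m | ≡ᵇ-false (u≢m ∘ ≡.sym) = refl
... | tri≈ _ refl _  rewrite <ᵇ-true (ℕₚ.n<1+n u) | ≡ᵇ-refl u | <ᵇ-false (ℕₚ.≤-refl {u}) = refl
... | tri> _ u≢m m<u rewrite <ᵇ-false m<u | <ᵇ-false (ℕₚ.<⇒≤ m<u) | ≡ᵇ-false (u≢m ∘ ≡.sym) = refl

countOcc-concat-zero : ∀ v w → countOcc v (concat w) ≡ 0 → All (λ B → countOcc v B ≡ 0) w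
countOcc-concat-zero v []      _    = []
countOcc-concat-zero v (B ∷ w) none =
  let none-split = ≡.trans (≡.sym (countOcc-++ v B (concat w))) none
  in ℕₚ.m+n≡0⇒m≡0 _ none-split ∷ countOcc-concat-zero v w (ℕₚ.m+n≡0⇒n≡0 (countOcc v B) none-split)

WellFormed⇒Avoids : ∀ m w → WellFormed m w → Avoids (suc m) w
WellFormed⇒Avoids m w (nonEmpty , τ , concat≡ , perm) =
  All.zip (nonEmpty , countOcc-concat-zero (suc m) w absent)
  where
  absent : countOcc (suc m) (concat w) ≡ 0
  absent = begin
    countOcc (suc m) (concat w)                        ≡⟨ cong (countOcc (suc m)) concat≡ ⟩
    countOcc (suc m) (τ ++ [ 0 ])                      ≡⟨ countOcc-++ (suc m) τ [ 0 ] ⟩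
    countOcc (suc m) τ + 0                             ≡⟨ ℕₚ.+-identityʳ _ ⟩
    countOcc (suc m) τ                                 ≡⟨ counts perm (suc m) ⟩
    ⟦ m <ᵇ m ⟧                                         ≡⟨ cong ⟦_⟧ (<ᵇ-false (ℕₚ.≤-refl {m})) ⟩
    0                                                  ∎
    where open ≡.≡-Reasoning

NonEmpty-++ : ∀ xs ys → NonEmpty xs → NonEmpty (xs ++ ys)
NonEmpty-++ (x ∷ xs) ys _ = tt

insert-nonEmpty : ∀ v c w → All NonEmpty w → All NonEmpty (insert v c w)
insert-nonEmpty v (zero  , fill)    (B ∷ B′ ∷ Bs) (ne ∷ _ ∷ nes)    = NonEmpty-++ B _ ne ∷ nes
insert-nonEmpty v (zero  , attachˡ) (B ∷ B′ ∷ Bs) (ne ∷ ne′ ∷ nes)  = NonEmpty-++ B _ ne ∷ ne′ ∷ nes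
insert-nonEmpty v (zero  , attachʳ) (B ∷ B′ ∷ Bs) (ne ∷ ne′ ∷ nes)  = ne ∷ tt ∷ nes
insert-nonEmpty v (zero  , alone)   (B ∷ B′ ∷ Bs) (ne ∷ ne′ ∷ nes)  = ne ∷ tt ∷ ne′ ∷ nes
insert-nonEmpty v (zero  , _)       []            nes               = nes
insert-nonEmpty v (zero  , _)       (B ∷ [])      nes               = nes
insert-nonEmpty v (suc g , s)       []            nes               = nes
insert-nonEmpty v (suc g , s)       (B ∷ Bs)      (ne ∷ nes)        = ne ∷ insert-nonEmpty v (g , s) Bs nes

concat-insert : ∀ v c w → InRange c w → All NonEmpty w →
  ∃[ P ] ∃[ S ] concat w ≡ P ++ S × concat (insert v c w) ≡ P ++ v ∷ S × NonEmpty P × NonEmpty S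
concat-insert v (zero , _)       (B ∷ [])      (s≤s ()) _
concat-insert v (zero , fill)    (B ∷ B′ ∷ Bs) _ (ne ∷ ne′ ∷ _) =
  B , B′ ++ concat Bs , refl , Listₚ.++-assoc B (v ∷ B′) (concat Bs) , ne , NonEmpty-++ B′ _ ne′
concat-insert v (zero , attachˡ) (B ∷ B′ ∷ Bs) _ (ne ∷ ne′ ∷ _) =
  B , B′ ++ concat Bs , refl , Listₚ.++-assoc B [ v ] _ , ne , NonEmpty-++ B′ _ ne′
concat-insert v (zero , attachʳ) (B ∷ B′ ∷ Bs) _ (ne ∷ ne′ ∷ _) =
  B , B′ ++ concat Bs , refl , refl , ne , NonEmpty-++ B′ _ ne′
concat-insert v (zero , alone)   (B ∷ B′ ∷ Bs) _ (ne ∷ ne′ ∷ _) =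
  B , B′ ++ concat Bs , refl , refl , ne , NonEmpty-++ B′ _ ne′
concat-insert v (suc g , s) (B ∷ Bs) (s≤s in-range) (ne ∷ nes) with concat-insert v (g , s) Bs in-range nes
... | P , S , concat≡ , concat-insert≡ , neP , neS =
  B ++ P , S , ≡.trans (cong (B ++_) concat≡) (≡.sym (Listₚ.++-assoc B P S)) ,
  ≡.trans (cong (B ++_) concat-insert≡) (≡.sym (Listₚ.++-assoc B P (v ∷ S))) , NonEmpty-++ B P ne , neS

∷ʳ-split : ∀ (τ : List ℕ) a P S → τ ++ [ a ] ≡ P ++ S → NonEmpty S → ∃[ S′ ] S ≡ S′ ++ [ a ] × τ ≡ P ++ S′
∷ʳ-split τ        a []      S       eq _   = τ , ≡.sym eq , refl
∷ʳ-split []       a (p ∷ []) (s ∷ S) () _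
∷ʳ-split []       a (p ∷ q ∷ P) S   () _
∷ʳ-split (x ∷ τ)  a (p ∷ P) S       eq neS with Listₚ.∷-injective eq
... | refl , eq′ with ∷ʳ-split τ a P S eq′ neS
...   | S′ , S≡ , τ≡ = S′ , S≡ , cong (x ∷_) τ≡

insert-wellFormed : ∀ m c w → InRange c w → WellFormed m w → WellFormed (suc m) (insert (suc m) c w)
insert-wellFormed m c w in-range (nonEmpty , τ , concat≡ , perm)
  with concat-insert (suc m) c w in-range nonEmpty
... | p ∷ P′ , S , concat≡P++S , concat-insert≡ , _ , neS with Listₚ.∷-injective (≡.trans (≡.sym concat≡P++S) concat≡)
... | refl , τ0≡P′S with ∷ʳ-split τ 0 P′ S (≡.sym τ0≡P′S) neS
... | S′ , refl , refl =
  insert-nonEmpty (suc m) c w nonEmpty , P′ ++ suc m ∷ S′ ,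
  ≡.trans concat-insert≡ (cong (0 ∷_) (≡.sym (Listₚ.++-assoc P′ (suc m ∷ S′) [ 0 ]))) , perm′
  where
  perm′ : IsPermutation (suc m) (P′ ++ suc m ∷ S′)
  perm′ .counts u = begin
    countOcc u (P′ ++ suc m ∷ S′)
      ≡⟨ countOcc-++ u P′ (suc m ∷ S′) ⟩
    countOcc u P′ + countOcc u (suc m ∷ S′)
      ≡⟨ cong (countOcc u P′ +_) (countOcc-cons u (suc m) S′) ⟩
    countOcc u P′ + (⟦ suc m ≡ᵇ u ⟧ + countOcc u S′)
      ≡⟨ +-x∙yz≈y∙xz (countOcc u P′) ⟦ suc m ≡ᵇ u ⟧ (countOcc u S′) ⟩
    ⟦ suc m ≡ᵇ u ⟧ + (countOcc u P′ + countOcc u S′)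
      ≡⟨ cong (⟦ suc m ≡ᵇ u ⟧ +_) (≡.trans (≡.sym (countOcc-++ u P′ S′)) (counts perm u)) ⟩
    ⟦ suc m ≡ᵇ u ⟧ + mult m u
      ≡⟨ ≡.sym (mult-suc m u) ⟩
    mult (suc m) u ∎
    where open ≡.≡-Reasoning

-- The block decomposition of a permutation

consHead : ℕ → Blocks → Blocks
consHead x []       = [ [ x ] ]
consHead x (B ∷ Bs) = (x ∷ B) ∷ Bs

openGap : Blocks → Blocks
openGap ([] ∷ Bs) = [] ∷ Bs
openGap w         = [] ∷ w

-- blocks m σ lists the maximal factors of 0σ0 made of letters ≤ m; suffixBlocks m s does the
-- same for s0, starting with an empty block when s starts with a letter > m.
suffixBlocks : ℕ → List ℕ → Blocks
suffixBlocks m []      = [ [ 0 ] ]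
suffixBlocks m (x ∷ s) = if x ≤ᵇ m then consHead x (suffixBlocks m s) else openGap (suffixBlocks m s)

blocks : ℕ → List ℕ → Blocks
blocks m σ = consHead 0 (suffixBlocks m σ)

headChoice : Blocks → Choice
headChoice ([] ∷ _) = 0 , attachˡ
headChoice _        = 0 , fill

detachˡ : Choice → Choice
detachˡ (zero , fill)    = zero , attachʳ
detachˡ (zero , attachˡ) = zero , alone
detachˡ c                = c

choiceAfterBig : Blocks → Choice → Choice
choiceAfterBig ([] ∷ _) c       = detachˡ c
choiceAfterBig _        (g , s) = suc g , s

insertionChoice : ℕ → List ℕ → Choice
insertionChoice m []      = 0 , fill
insertionChoice m (x ∷ s) =
  if x ≤ᵇ m then insertionChoice m s
  else if x ≡ᵇ suc m then headChoice (suffixBlocks m s)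
  else choiceAfterBig (suffixBlocks m s) (insertionChoice m s)

data HeadShape : Blocks → Set where
  emptyHead    : ∀ B Bs → HeadShape ([] ∷ B ∷ Bs)
  nonEmptyHead : ∀ b B Bs → HeadShape ((b ∷ B) ∷ Bs)

suffixBlocks-shape : ∀ m s → HeadShape (suffixBlocks m s)
suffixBlocks-shape m []      = nonEmptyHead 0 [] []
suffixBlocks-shape m (x ∷ s) with x ≤ᵇ m | suffixBlocks m s | suffixBlocks-shape m s
... | true  | _ | emptyHead B Bs      = nonEmptyHead x [] (B ∷ Bs)
... | true  | _ | nonEmptyHead b B Bs = nonEmptyHead x (b ∷ B) Bs
... | false | _ | emptyHead B Bs      = emptyHead B Bs
... | false | _ | nonEmptyHead b B Bs = emptyHead (b ∷ B) Bs

data Kind (m x : ℕ) : Set where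
  small : (x ≤ᵇ m) ≡ true → (x ≤ᵇ suc m) ≡ true → (x ≡ᵇ suc m) ≡ false → Kind m x
  new   : x ≡ suc m → Kind m x
  big   : (x ≤ᵇ m) ≡ false → (x ≤ᵇ suc m) ≡ false → (x ≡ᵇ suc m) ≡ false → Kind m x

kind : ∀ m x → Kind m x
kind m x with ℕₚ.<-cmp x (suc m)
... | tri< x<1+m x≢1+m _ = small (≤ᵇ-true (ℕₚ.≤-pred x<1+m)) (≤ᵇ-true (ℕₚ.<⇒≤ x<1+m)) (≡ᵇ-false x≢1+m)
... | tri≈ _ x≡1+m _     = new x≡1+m
... | tri> _ x≢1+m 1+m<x = big (≤ᵇ-false (ℕₚ.<-trans (ℕₚ.n<1+n m) 1+m<x)) (≤ᵇ-false 1+m<x) (≡ᵇ-false x≢1+m)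

consHead-insert : ∀ v x c w → consHead x (insert v c w) ≡ insert v c (consHead x w)
consHead-insert v x (zero  , s)       []            = refl
consHead-insert v x (zero  , s)       (B ∷ [])      = refl
consHead-insert v x (zero  , fill)    (B ∷ B′ ∷ Bs) = refl
consHead-insert v x (zero  , attachˡ) (B ∷ B′ ∷ Bs) = refl
consHead-insert v x (zero  , attachʳ) (B ∷ B′ ∷ Bs) = refl
consHead-insert v x (zero  , alone)   (B ∷ B′ ∷ Bs) = refl
consHead-insert v x (suc zero , s)    []            = refl
consHead-insert v x (suc (suc g) , s) []            = refl
consHead-insert v x (suc g , s)       (B ∷ Bs)      = refl

consHead≡insert-headChoice : ∀ v {w} → HeadShape w → consHead v w ≡ insert v (headChoice w) (openGap w)
consHead≡insert-headChoice v (emptyHead B Bs)      = refl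
consHead≡insert-headChoice v (nonEmptyHead b B Bs) = refl

openGap-insert : ∀ v c {w} → HeadShape w → openGap (insert v c w) ≡ insert v (choiceAfterBig w c) (openGap w)
openGap-insert v (zero  , fill)    (emptyHead B Bs)            = refl
openGap-insert v (zero  , attachˡ) (emptyHead B Bs)            = refl
openGap-insert v (zero  , attachʳ) (emptyHead B Bs)            = refl
openGap-insert v (zero  , alone)   (emptyHead B Bs)            = refl
openGap-insert v (suc g , s)       (emptyHead B Bs)            = refl
openGap-insert v (zero  , s)       (nonEmptyHead b B [])       = refl
openGap-insert v (zero  , fill)    (nonEmptyHead b B (B′ ∷ Bs)) = refl
openGap-insert v (zero  , attachˡ) (nonEmptyHead b B (B′ ∷ Bs)) = refl
openGap-insert v (zero  , attachʳ) (nonEmptyHead b B (B′ ∷ Bs)) = refl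
openGap-insert v (zero  , alone)   (nonEmptyHead b B (B′ ∷ Bs)) = refl
openGap-insert v (suc g , s)       (nonEmptyHead b B Bs)       = refl

suffixBlocks-absent : ∀ m s → countOcc (suc m) s ≡ 0 → suffixBlocks (suc m) s ≡ suffixBlocks m s
suffixBlocks-absent m []      _    = refl
suffixBlocks-absent m (x ∷ s) none with kind m x
... | small x≤m x≤1+m x≢1+m rewrite x≤m | x≤1+m =
  cong (consHead x) (suffixBlocks-absent m s (≡.trans (≡.sym (countOcc-≢ x s x≢1+m)) none))
... | new refl with () ← ≡.trans (≡.sym (countOcc-self (suc m) s)) none
... | big x≰m x≰1+m x≢1+m rewrite x≰m | x≰1+m =
  cong openGap (suffixBlocks-absent m s (≡.trans (≡.sym (countOcc-≢ x s x≢1+m)) none))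

suffixBlocks-suc : ∀ m s → countOcc (suc m) s ≡ 1 →
                   suffixBlocks (suc m) s ≡ insert (suc m) (insertionChoice m s) (suffixBlocks m s)
suffixBlocks-suc m (x ∷ s) once with kind m x
... | small x≤m x≤1+m x≢1+m rewrite x≤m | x≤1+m =
  ≡.trans (cong (consHead x) (suffixBlocks-suc m s (≡.trans (≡.sym (countOcc-≢ x s x≢1+m)) once)))
          (consHead-insert (suc m) x (insertionChoice m s) (suffixBlocks m s))
... | new refl rewrite ≤ᵇ-true (ℕₚ.≤-refl {suc m}) | ≤ᵇ-false (ℕₚ.n<1+n m) | ≡ᵇ-refl m =
  ≡.trans (cong (consHead (suc m)) (suffixBlocks-absent m s (ℕₚ.suc-injective once)))
          (consHead≡insert-headChoice (suc m) (suffixBlocks-shape m s))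
... | big x≰m x≰1+m x≢1+m rewrite x≰m | x≰1+m | x≢1+m =
  ≡.trans (cong openGap (suffixBlocks-suc m s once))
          (openGap-insert (suc m) (insertionChoice m s) (suffixBlocks-shape m s))

length-consHead : ∀ x {w} → HeadShape w → length (consHead x w) ≡ length w
length-consHead x (emptyHead B Bs)      = refl
length-consHead x (nonEmptyHead b B Bs) = refl

headChoice-inRange : ∀ {w} → HeadShape w → InRange (headChoice w) (openGap w)
headChoice-inRange (emptyHead B Bs)      = s≤s (s≤s z≤n)
headChoice-inRange (nonEmptyHead b B Bs) = s≤s (s≤s z≤n)

detachˡ-gap : ∀ c → proj₁ (detachˡ c) ≡ proj₁ c
detachˡ-gap (zero  , fill)    = refl
detachˡ-gap (zero  , attachˡ) = refl
detachˡ-gap (zero  , attachʳ) = refl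
detachˡ-gap (zero  , alone)   = refl
detachˡ-gap (suc g , s)       = refl

choiceAfterBig-inRange : ∀ c {w} → HeadShape w → InRange c w → InRange (choiceAfterBig w c) (openGap w)
choiceAfterBig-inRange c       (emptyHead B Bs)      in-range rewrite detachˡ-gap c = in-range
choiceAfterBig-inRange (g , s) (nonEmptyHead b B Bs) in-range = s≤s in-range

insertionChoice-inRange : ∀ m s → countOcc (suc m) s ≡ 1 → InRange (insertionChoice m s) (suffixBlocks m s)
insertionChoice-inRange m (x ∷ s) once with kind m x
... | small x≤m _ x≢1+m rewrite x≤m =
  ≡.subst (suc (proj₁ (insertionChoice m s)) <_) (≡.sym (length-consHead x (suffixBlocks-shape m s)))
    (insertionChoice-inRange m s (≡.trans (≡.sym (countOcc-≢ x s x≢1+m)) once))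
... | new refl rewrite ≤ᵇ-false (ℕₚ.n<1+n m) | ≡ᵇ-refl m = headChoice-inRange (suffixBlocks-shape m s)
... | big x≰m _ x≢1+m rewrite x≰m | x≢1+m =
  choiceAfterBig-inRange (insertionChoice m s) (suffixBlocks-shape m s) (insertionChoice-inRange m s once)

blocks-suc : ∀ m σ → countOcc (suc m) σ ≡ 1 → blocks (suc m) σ ≡ insert (suc m) (insertionChoice m σ) (blocks m σ)
blocks-suc m σ once = ≡.trans (cong (consHead 0) (suffixBlocks-suc m σ once))
                              (consHead-insert (suc m) 0 (insertionChoice m σ) (suffixBlocks m σ))

blocks-inRange : ∀ m σ → countOcc (suc m) σ ≡ 1 → InRange (insertionChoice m σ) (blocks m σ)
blocks-inRange m σ once = ≡.subst (suc (proj₁ (insertionChoice m σ)) <_)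
  (≡.sym (length-consHead 0 (suffixBlocks-shape m σ))) (insertionChoice-inRange m σ once)

data TailNonEmpty : Blocks → Set where
  tailNonEmpty : ∀ B Bs → All NonEmpty Bs → TailNonEmpty (B ∷ Bs)

suffixBlocks-tailNonEmpty : ∀ m s → TailNonEmpty (suffixBlocks m s)
suffixBlocks-tailNonEmpty m []      = tailNonEmpty _ _ []
suffixBlocks-tailNonEmpty m (x ∷ s) with x ≤ᵇ m | suffixBlocks m s | suffixBlocks-tailNonEmpty m s
... | true  | _ | tailNonEmpty B       Bs nes = tailNonEmpty _ _ nes
... | false | _ | tailNonEmpty []      Bs nes = tailNonEmpty _ _ nes
... | false | _ | tailNonEmpty (b ∷ B) Bs nes = tailNonEmpty _ _ (tt ∷ nes)

blocks-nonEmpty : ∀ m σ → All NonEmpty (blocks m σ)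
blocks-nonEmpty m σ with suffixBlocks m σ | suffixBlocks-tailNonEmpty m σ
... | _ | tailNonEmpty B Bs nes = tt ∷ nes

concat-suffixBlocks : ∀ m s → concat (suffixBlocks m s) ≡ filterᵇ (_≤ᵇ m) s ++ [ 0 ]
concat-suffixBlocks m []      = refl
concat-suffixBlocks m (x ∷ s) with x ≤ᵇ m | suffixBlocks m s | suffixBlocks-shape m s | concat-suffixBlocks m s
... | true  | _ | emptyHead B Bs      | concat≡ = cong (x ∷_) concat≡
... | true  | _ | nonEmptyHead b B Bs | concat≡ = cong (x ∷_) concat≡
... | false | _ | emptyHead B Bs      | concat≡ = concat≡
... | false | _ | nonEmptyHead b B Bs | concat≡ = concat≡

countOcc-filterᵇ-kept : ∀ (p : ℕ → Bool) u σ → p u ≡ true → countOcc u (filterᵇ p σ) ≡ countOcc u σ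
countOcc-filterᵇ-kept p u []      _  = refl
countOcc-filterᵇ-kept p u (x ∷ σ) pu with p x in px
... | true = ≡.trans (countOcc-cons u x (filterᵇ p σ))
               (≡.trans (cong (⟦ x ≡ᵇ u ⟧ +_) (countOcc-filterᵇ-kept p u σ pu)) (≡.sym (countOcc-cons u x σ)))
... | false with x ≡ᵇ u in x≟u
...   | false = countOcc-filterᵇ-kept p u σ pu
...   | true with refl ← ≡ᵇ-sound {x} {u} x≟u with () ← ≡.trans (≡.sym pu) px

countOcc-filterᵇ-dropped : ∀ (p : ℕ → Bool) u σ → p u ≡ false → countOcc u (filterᵇ p σ) ≡ 0
countOcc-filterᵇ-dropped p u []      _   = refl
countOcc-filterᵇ-dropped p u (x ∷ σ) ¬pu with p x in px
... | false = countOcc-filterᵇ-dropped p u σ ¬pu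
... | true with x ≡ᵇ u in x≟u
...   | false = countOcc-filterᵇ-dropped p u σ ¬pu
...   | true with refl ← ≡ᵇ-sound {x} {u} x≟u with () ← ≡.trans (≡.sym ¬pu) px

mult-≤ : ∀ {m n} u → m ≤ n → u ≤ m → mult n u ≡ mult m u
mult-≤ zero    _   _   = refl
mult-≤ (suc u) m≤n u<m = cong ⟦_⟧ (≡.trans (<ᵇ-true (ℕₚ.<-≤-trans u<m m≤n)) (≡.sym (<ᵇ-true u<m)))

mult-> : ∀ {m} u → m < u → mult m u ≡ 0
mult-> (suc u) (s≤s m≤u) = cong ⟦_⟧ (<ᵇ-false m≤u)

filterᵇ-≤-permutation : ∀ {m n σ} → m ≤ n → IsPermutation n σ → IsPermutation m (filterᵇ (_≤ᵇ m) σ)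
filterᵇ-≤-permutation {m} {n} {σ} m≤n perm .counts u with ℕₚ.≤-<-connex u m
... | inj₁ u≤m =
  ≡.trans (countOcc-filterᵇ-kept (_≤ᵇ m) u σ (≤ᵇ-true u≤m)) (≡.trans (counts perm u) (mult-≤ u m≤n u≤m))
... | inj₂ m<u = ≡.trans (countOcc-filterᵇ-dropped (_≤ᵇ m) u σ (≤ᵇ-false m<u)) (≡.sym (mult-> u m<u))

blocks-wellFormed : ∀ {m n} σ → m ≤ n → IsPermutation n σ → WellFormed m (blocks m σ)
blocks-wellFormed {m} σ m≤n perm with suffixBlocks m σ | concat-suffixBlocks m σ | blocks-nonEmpty m σ
... | []     | concat≡ | _        = ⊥-elim ([]≢∷ʳ (filterᵇ (_≤ᵇ m) σ) concat≡)
  where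
  []≢∷ʳ : ∀ (xs : List ℕ) {a} → [] ≢ xs ++ [ a ]
  []≢∷ʳ []       ()
  []≢∷ʳ (x ∷ xs) ()
... | B ∷ Bs | concat≡ | nonEmpty = nonEmpty , filterᵇ (_≤ᵇ m) σ , cong (0 ∷_) concat≡ , filterᵇ-≤-permutation m≤n perm

countOcc-member : ∀ σ → All (λ x → 1 ≤ countOcc x σ) σ
countOcc-member []      = []
countOcc-member (x ∷ σ) = ≡.subst (1 ≤_) (≡.sym (countOcc-self x σ)) (s≤s z≤n) ∷ All.map later (countOcc-member σ)
  where
  later : ∀ {y} → 1 ≤ countOcc y σ → 1 ≤ countOcc y (x ∷ σ)
  later {y} 1≤count = ℕₚ.≤-trans 1≤count (≡.subst (countOcc y σ ≤_) (≡.sym (countOcc-cons y x σ)) (ℕₚ.m≤n+m _ _))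

permutation-elements : ∀ {n σ} → IsPermutation n σ → All (λ x → mult n x ≡ 1) σ
permutation-elements {n} {σ} perm =
  All.map (λ {x} 1≤count → positive x (≡.subst (1 ≤_) (counts perm x) 1≤count)) (countOcc-member σ)
  where
  positive : ∀ x → 1 ≤ mult n x → mult n x ≡ 1
  positive (suc x) 1≤mult with x <ᵇ n
  ... | true = refl

mult≡1⇒≤ : ∀ {n} x → mult n x ≡ 1 → x ≤ n
mult≡1⇒≤ {n} (suc x) x∈ with x <ᵇ n in x<ᵇn
... | true = <ᵇ-sound x<ᵇn

mult≡1⇒positive : ∀ {n} x → mult n x ≡ 1 → 0 < x
mult≡1⇒positive (suc x) _ = s≤s z≤n

permutation-≤ : ∀ {n σ} → IsPermutation n σ → All (_≤ n) σ
permutation-≤ perm = All.map (λ {x} → mult≡1⇒≤ x) (permutation-elements perm)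

suffixBlocks-small : ∀ m s → All (λ x → x ≤ m) s → suffixBlocks m s ≡ [ s ++ [ 0 ] ]
suffixBlocks-small m []      []             = refl
suffixBlocks-small m (x ∷ s) (x≤m ∷ s≤m) rewrite ≤ᵇ-true x≤m | suffixBlocks-small m s s≤m = refl

suffixBlocks-zero : ∀ x s → All (0 <_) (x ∷ s) → suffixBlocks 0 (x ∷ s) ≡ [] ∷ [ 0 ] ∷ []
suffixBlocks-zero x []      (0<x ∷ [])      rewrite ≤ᵇ-false 0<x = refl
suffixBlocks-zero x (y ∷ s) (0<x ∷ 0<y∷s) rewrite ≤ᵇ-false 0<x | suffixBlocks-zero y s 0<y∷s = refl

-- Occurrences of 31-2

strictlyBetween : ℕ → ℕ → ℕ → Bool
strictlyBetween a b z = (b <ᵇ z) ∧ (z <ᵇ a)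

-- Counts the occurrences (i , k) of 31-2 whose letter σ_k satisfies p.
occ31-2-with : (ℕ → Bool) → List ℕ → ℕ
occ31-2-with p (a ∷ b ∷ rest) = length (filterᵇ (λ z → strictlyBetween a b z ∧ p z) rest) + occ31-2-with p (b ∷ rest)
occ31-2-with p _              = 0

occAbove occAt : ℕ → List ℕ → ℕ
occAbove m = occ31-2-with (m <ᵇ_)
occAt    m = occ31-2-with (_≡ᵇ suc m)

occ31-2-with-split : ∀ {p q r : ℕ → Bool} → (∀ z → ⟦ p z ⟧ ≡ ⟦ q z ⟧ + ⟦ r z ⟧) → ∀ s →
                     occ31-2-with p s ≡ occ31-2-with q s + occ31-2-with r s
occ31-2-with-split {p} {q} {r} split (a ∷ s@(b ∷ rest)) =
  ≡.trans (cong₂ _+_ (length-filterᵇ-split {p = λ z → strictlyBetween a b z ∧ p z} conjunct rest) (occ31-2-with-split split s))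
          (+-interchange (row q) (row r) (occ31-2-with q s) (occ31-2-with r s))
  where
  row : (ℕ → Bool) → ℕ
  row t = length (filterᵇ (λ z → strictlyBetween a b z ∧ t z) rest)
  conjunct : ∀ z → ⟦ strictlyBetween a b z ∧ p z ⟧ ≡ ⟦ strictlyBetween a b z ∧ q z ⟧ + ⟦ strictlyBetween a b z ∧ r z ⟧
  conjunct z with strictlyBetween a b z
  ... | true  = split z
  ... | false = refl
occ31-2-with-split split []      = refl
occ31-2-with-split split (a ∷ []) = refl

occAbove-split : ∀ m s → occAbove m s ≡ occAt m s + occAbove (suc m) s
occAbove-split m = occ31-2-with-split threshold
  where
  threshold : ∀ z → ⟦ m <ᵇ z ⟧ ≡ ⟦ z ≡ᵇ suc m ⟧ + ⟦ suc m <ᵇ z ⟧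
  threshold z with ℕₚ.<-cmp z (suc m)
  ... | tri< z<1+m z≢1+m _ rewrite <ᵇ-false (ℕₚ.≤-pred z<1+m) | ≡ᵇ-false z≢1+m | <ᵇ-false (ℕₚ.<⇒≤ z<1+m) = refl
  ... | tri≈ _ refl _      rewrite <ᵇ-true (ℕₚ.n<1+n m) | ≡ᵇ-refl (suc m) | <ᵇ-false (ℕₚ.≤-refl {suc m}) = refl
  ... | tri> _ z≢1+m 1+m<z rewrite <ᵇ-true (ℕₚ.<-trans (ℕₚ.n<1+n m) 1+m<z) | ≡ᵇ-false z≢1+m | <ᵇ-true 1+m<z = refl

countBetween : ∀ a b v rest →
  length (filterᵇ (λ z → strictlyBetween a b z ∧ (z ≡ᵇ v)) rest) ≡ (if strictlyBetween a b v then countOcc v rest else 0)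
countBetween a b v rest with strictlyBetween a b v in between
... | true  = cong length (filterᵇ-≗ pointwise rest)
  where
  pointwise : ∀ z → strictlyBetween a b z ∧ (z ≡ᵇ v) ≡ (z ≡ᵇ v)
  pointwise z with z ≡ᵇ v in z≟v
  ... | false = ∧-zeroʳ _
  ... | true with refl ← ≡ᵇ-sound {z} {v} z≟v = ≡.trans (∧-identityʳ _) between
... | false = cong length (filterᵇ-none _ rest (All.tabulate (λ {z} _ → pointwise z)))
  where
  pointwise : ∀ z → strictlyBetween a b z ∧ (z ≡ᵇ v) ≡ false
  pointwise z with z ≡ᵇ v in z≟v
  ... | false = ∧-zeroʳ _
  ... | true with refl ← ≡ᵇ-sound {z} {v} z≟v = ≡.trans (∧-identityʳ _) between

headOcc : ℕ → ℕ → List ℕ → ℕ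
headOcc m x []         = 0
headOcc m x (y ∷ rest) = length (filterᵇ (λ z → strictlyBetween x y z ∧ (z ≡ᵇ suc m)) rest)

occAt-cons : ∀ m x s → occAt m (x ∷ s) ≡ headOcc m x s + occAt m s
occAt-cons m x []      = refl
occAt-cons m x (y ∷ s) = refl

headOcc-outside : ∀ m x y rest → strictlyBetween x y (suc m) ≡ false → headOcc m x (y ∷ rest) ≡ 0
headOcc-outside m x y rest outside = ≡.trans (countBetween x y (suc m) rest) (cong (λ b → if b then _ else 0) outside)

occAt-absent : ∀ m s → countOcc (suc m) s ≡ 0 → occAt m s ≡ 0
occAt-absent m []               _    = refl
occAt-absent m (a ∷ [])         _    = refl
occAt-absent m (a ∷ s@(b ∷ rest)) none =
  cong₂ _+_ (≡.trans (countBetween a b (suc m) rest) (vanish (strictlyBetween a b (suc m)))) (occAt-absent m s none′)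
  where
  none′ = proj₂ (countOcc-cons-zero a s none)
  vanish : ∀ c → (if c then countOcc (suc m) rest else 0) ≡ 0
  vanish true  = proj₂ (countOcc-cons-zero b rest none′)
  vanish false = refl

headChoice-gap : ∀ w → proj₁ (headChoice w) ≡ 0
headChoice-gap []            = refl
headChoice-gap ([] ∷ _)      = refl
headChoice-gap ((_ ∷ _) ∷ _) = refl

choiceAfterBig-consHead : ∀ y w c → proj₁ (choiceAfterBig (consHead y w) c) ≡ suc (proj₁ c)
choiceAfterBig-consHead y []       c = refl
choiceAfterBig-consHead y (B ∷ Bs) c = refl

choiceAfterBig-openGap : ∀ w c → proj₁ (choiceAfterBig (openGap w) c) ≡ proj₁ c
choiceAfterBig-openGap []            c = detachˡ-gap c
choiceAfterBig-openGap ([] ∷ Bs)     c = detachˡ-gap c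
choiceAfterBig-openGap ((b ∷ B) ∷ Bs) c = detachˡ-gap c

headOcc-≤ : ∀ m x s → x ≤ suc m → headOcc m x s ≡ 0
headOcc-≤ m x []         _      = refl
headOcc-≤ m x (y ∷ rest) x≤1+m =
  headOcc-outside m x y rest (≡.trans (cong ((y <ᵇ suc m) ∧_) (<ᵇ-false x≤1+m)) (∧-zeroʳ _))

headOcc-big : ∀ m x s → suc m < x → countOcc (suc m) s ≡ 1 →
  headOcc m x s + proj₁ (insertionChoice m s) ≡ proj₁ (choiceAfterBig (suffixBlocks m s) (insertionChoice m s))
headOcc-big m x (y ∷ rest) 1+m<x once with kind m y
... | small y≤m _ y≢1+m rewrite y≤m =
  ≡.trans (cong (_+ _) between) (≡.sym (choiceAfterBig-consHead y (suffixBlocks m rest) (insertionChoice m rest)))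
  where
  inside : strictlyBetween x y (suc m) ≡ true
  inside = cong₂ _∧_ (<ᵇ-true (s≤s (≤ᵇ-sound {y} {m} y≤m))) (<ᵇ-true 1+m<x)
  between : headOcc m x (y ∷ rest) ≡ 1
  between = begin
    headOcc m x (y ∷ rest)
      ≡⟨ countBetween x y (suc m) rest ⟩
    (if strictlyBetween x y (suc m) then countOcc (suc m) rest else 0)
      ≡⟨ cong (λ b → if b then countOcc (suc m) rest else 0) inside ⟩
    countOcc (suc m) rest
      ≡⟨ ≡.trans (≡.sym (countOcc-≢ y rest y≢1+m)) once ⟩
    1 ∎
    where open ≡.≡-Reasoning
... | new refl rewrite ≤ᵇ-false (ℕₚ.n<1+n m) =
  ≡.trans (cong (_+ _) (headOcc-outside m x (suc m) rest (cong (_∧ (suc m <ᵇ x)) (<ᵇ-false (ℕₚ.≤-refl {suc m})))))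
          (≡.sym (choiceAfterBig-openGap (suffixBlocks m rest) _))
... | big y≰m y≰1+m _ rewrite y≰m =
  ≡.trans (cong (_+ _) (headOcc-outside m x y rest (cong (_∧ (suc m <ᵇ x)) (<ᵇ-false (ℕₚ.<⇒≤ 1+m<y)))))
          (≡.sym (choiceAfterBig-openGap (suffixBlocks m rest) _))
  where
  1+m<y : suc m < y
  1+m<y = ≤ᵇ-false-sound {y} {suc m} y≰1+m

-- Each gap to the left of the one holding m + 1 ends with a descent from a letter > m + 1 into
-- the next block; these descents are exactly the occurrences of 31-2 whose 2 is m + 1.
occAt≡insertionGap : ∀ m s → countOcc (suc m) s ≡ 1 → occAt m s ≡ proj₁ (insertionChoice m s)
occAt≡insertionGap m (x ∷ s) once with kind m x
... | small x≤m _ x≢1+m rewrite x≤m = ≡.trans (occAt-cons m x s)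
  (cong₂ _+_ (headOcc-≤ m x s (ℕₚ.m≤n⇒m≤1+n (≤ᵇ-sound {x} {m} x≤m)))
             (occAt≡insertionGap m s (≡.trans (≡.sym (countOcc-≢ x s x≢1+m)) once)))
... | new refl rewrite ≤ᵇ-false (ℕₚ.n<1+n m) | ≡ᵇ-refl m = ≡.trans (occAt-cons m (suc m) s)
  (≡.trans (cong₂ _+_ (headOcc-≤ m (suc m) s ℕₚ.≤-refl) (occAt-absent m s (ℕₚ.suc-injective once)))
           (≡.sym (headChoice-gap (suffixBlocks m s))))
... | big x≰m x≰1+m x≢1+m rewrite x≰m | x≢1+m = ≡.trans (occAt-cons m x s)
  (≡.trans (cong (headOcc m x s +_) (occAt≡insertionGap m s once))
           (headOcc-big m x s (≤ᵇ-false-sound {x} {suc m} x≰1+m) once))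

allᵇ-sound : ∀ p xs → allᵇ p xs ≡ true → All (λ x → p x ≡ true) xs
allᵇ-sound p []       _   = []
allᵇ-sound p (x ∷ xs) all with p x in px
... | true = px ∷ allᵇ-sound p xs all

allᵇ-complete : ∀ p {xs} → All (λ x → p x ≡ true) xs → allᵇ p xs ≡ true
allᵇ-complete p []           = refl
allᵇ-complete p (px ∷ rest) rewrite px = allᵇ-complete p rest

vals-elements : ∀ n → All (λ v → mult n v ≡ 1) (vals n)
vals-elements n = Allₚ.map⁺ (All.map (cong ⟦_⟧ ∘ <ᵇ-true) (Allₚ.all-upTo n))

mult≡1⇒∈vals : ∀ n u → mult n u ≡ 1 → u ∈ vals n
mult≡1⇒∈vals n (suc i) u∈ with i <ᵇ n in i<ᵇn
... | true = ∈-map⁺ suc (∈-upTo⁺ (<ᵇ-sound i<ᵇn))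

vals-suc : ∀ n → vals (suc n) ≡ vals n ++ [ suc n ]
vals-suc n = ≡.trans (cong (map suc) (≡.sym (Listₚ.upTo-∷ʳ n))) (Listₚ.map-++ suc (upTo n) [ n ])

vals-permutation : ∀ n → IsPermutation n (vals n)
vals-permutation zero    .counts zero    = refl
vals-permutation zero    .counts (suc u) = refl
vals-permutation (suc n) .counts u = begin
  countOcc u (vals (suc n))
    ≡⟨ cong (countOcc u) (vals-suc n) ⟩
  countOcc u (vals n ++ [ suc n ])
    ≡⟨ countOcc-++ u (vals n) [ suc n ] ⟩
  countOcc u (vals n) + countOcc u [ suc n ]
    ≡⟨ cong₂ _+_ (counts (vals-permutation n) u) (≡.trans (countOcc-cons u (suc n) []) (ℕₚ.+-identityʳ _)) ⟩
  mult n u + ⟦ suc n ≡ᵇ u ⟧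
    ≡⟨ ℕₚ.+-comm (mult n u) _ ⟩
  ⟦ suc n ≡ᵇ u ⟧ + mult n u
    ≡⟨ ≡.sym (mult-suc n u) ⟩
  mult (suc n) u ∎
  where open ≡.≡-Reasoning

permutation-length : ∀ {n τ} → IsPermutation n τ → length τ ≡ n
permutation-length {n} {τ} perm = begin
  length τ            ≡⟨ ↭ₚ.↭-length (ℕ-Multiplicity.multiplicity-≗⇒↭ τ (vals n) same-counts) ⟩
  length (vals n)     ≡⟨ Listₚ.length-map suc (upTo n) ⟩
  length (upTo n)     ≡⟨ Listₚ.length-upTo n ⟩
  n                   ∎
  where
  open ≡.≡-Reasoning
  same-counts : ∀ u → countOcc u τ ≡ countOcc u (vals n)
  same-counts u = ≡.trans (counts perm u) (≡.sym (counts (vals-permutation n) u))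

words-elements : ∀ l m → All (λ σ → length σ ≡ l × All (λ x → mult m x ≡ 1) σ) (words l m)
words-elements zero    m = (refl , []) ∷ []
words-elements (suc l) m = Allₚ.concat⁺ (Allₚ.map⁺ (All.map prefixed (vals-elements m)))
  where
  prefixed : ∀ {v} → mult m v ≡ 1 → All (λ σ → length σ ≡ suc l × All (λ x → mult m x ≡ 1) σ) (map (v ∷_) (words l m))
  prefixed v∈ = Allₚ.map⁺ (All.map (λ (len , elems) → cong suc len , v∈ ∷ elems) (words-elements l m))

mult-0∨1 : ∀ n u → mult n u ≡ 0 ⊎ mult n u ≡ 1
mult-0∨1 n zero    = inj₁ refl
mult-0∨1 n (suc u) with u <ᵇ n
... | true  = inj₂ refl
... | false = inj₁ refl

countOcc-outside : ∀ {n} u σ → All (λ x → mult n x ≡ 1) σ → mult n u ≡ 0 → countOcc u σ ≡ 0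
countOcc-outside u []      _              _       = refl
countOcc-outside u (x ∷ σ) (x∈ ∷ elems) u∉ = ≡.trans (countOcc-≢ x σ (≡ᵇ-false x≢u)) (countOcc-outside u σ elems u∉)
  where
  x≢u : x ≢ u
  x≢u refl with () ← ≡.trans (≡.sym x∈) u∉

perms-permutation : ∀ n → All (IsPermutation n) (perms n)
perms-permutation n = All.map (λ ((_ , elems) , isPerm≡true) → permutation elems isPerm≡true)
                               (filterᵇ-All (isPerm n) (words-elements n n))
  where
  permutation : ∀ {σ} → All (λ x → mult n x ≡ 1) σ → isPerm n σ ≡ true → IsPermutation n σ
  permutation {σ} elems isPerm≡true .counts u with mult-0∨1 n u
  ... | inj₁ u∉ = ≡.trans (countOcc-outside u σ elems u∉) (≡.sym u∉)
  ... | inj₂ u∈ = ≡.trans (≡ᵇ-sound (All.lookup (allᵇ-sound _ (vals n) isPerm≡true) (mult≡1⇒∈vals n u u∈))) (≡.sym u∈)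

concat-singleton : ∀ {A : Set} (G : ℕ → List A) x y V → countOcc x V ≡ 1 → (∀ v → (v ≡ᵇ x) ≡ false → G v ≡ []) →
                   G x ≡ [ y ] → concat (map G V) ≡ [ y ]
concat-singleton G x y (v ∷ V) once elsewhere at-x with v ≡ᵇ x in v≟x
... | true rewrite ≡ᵇ-sound {v} {x} v≟x | at-x = cong (y ∷_) (nowhere V (ℕₚ.suc-injective once))
  where
  nowhere : ∀ V → countOcc x V ≡ 0 → concat (map G V) ≡ []
  nowhere []      _    = refl
  nowhere (v ∷ V) none with countOcc-cons-zero v V none
  ... | v≢x , none′ rewrite elsewhere v v≢x = nowhere V none′
... | false rewrite elsewhere v v≟x = concat-singleton G x y V once elsewhere at-x

words-unique : ∀ l m τ → length τ ≡ l → All (λ x → mult m x ≡ 1) τ → filterᵇ (_==ᴸ τ) (words l m) ≡ [ τ ]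
words-unique zero    m []      _   _              = refl
words-unique (suc l) m (x ∷ τ) len (x∈ ∷ elems) = begin
  filterᵇ (_==ᴸ x ∷ τ) (concat (map (λ v → map (v ∷_) (words l m)) (vals m)))
    ≡⟨ filterᵇ-concat _ (map (λ v → map (v ∷_) (words l m)) (vals m)) ⟩
  concat (map (filterᵇ (_==ᴸ x ∷ τ)) (map (λ v → map (v ∷_) (words l m)) (vals m)))
    ≡⟨ cong concat (≡.sym (Listₚ.map-∘ (vals m))) ⟩
  concat (map (λ v → filterᵇ (_==ᴸ x ∷ τ) (map (v ∷_) (words l m))) (vals m))
    ≡⟨ concat-singleton _ x (x ∷ τ) (vals m) (≡.trans (counts (vals-permutation m) x) x∈) elsewhere at-x ⟩
  [ x ∷ τ ] ∎
  where
  open ≡.≡-Reasoning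
  prefixed : ∀ v → filterᵇ (_==ᴸ x ∷ τ) (map (v ∷_) (words l m)) ≡
                    map (v ∷_) (filterᵇ (λ σ → (v ≡ᵇ x) ∧ (σ ==ᴸ τ)) (words l m))
  prefixed v = filterᵇ-map _ (v ∷_) (words l m)
  elsewhere : ∀ v → (v ≡ᵇ x) ≡ false → filterᵇ (_==ᴸ x ∷ τ) (map (v ∷_) (words l m)) ≡ []
  elsewhere v v≢x = ≡.trans (prefixed v)
    (cong (map (v ∷_)) (filterᵇ-none _ (words l m) (All.tabulate (λ {σ} _ → cong (_∧ (σ ==ᴸ τ)) v≢x))))
  at-x : filterᵇ (_==ᴸ x ∷ τ) (map (x ∷_) (words l m)) ≡ [ x ∷ τ ]
  at-x = ≡.trans (prefixed x) (cong (map (x ∷_))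
    (≡.trans (filterᵇ-≗ (λ σ → cong (_∧ (σ ==ᴸ τ)) (≡ᵇ-refl x)) (words l m))
             (words-unique l m τ (ℕₚ.suc-injective len) elems)))

perms-unique : ∀ n τ → IsPermutation n τ → filterᵇ (_==ᴸ τ) (perms n) ≡ [ τ ]
perms-unique n τ perm = begin
  filterᵇ (_==ᴸ τ) (filterᵇ (isPerm n) (words n n))
    ≡⟨ filterᵇ-comm (_==ᴸ τ) (isPerm n) (words n n) ⟩
  filterᵇ (isPerm n) (filterᵇ (_==ᴸ τ) (words n n))
    ≡⟨ cong (filterᵇ (isPerm n)) (words-unique n n τ (permutation-length perm) (permutation-elements perm)) ⟩
  filterᵇ (isPerm n) [ τ ]
    ≡⟨ filterᵇ-all (isPerm n) (isPerm≡true ∷ []) ⟩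
  [ τ ] ∎
  where
  open ≡.≡-Reasoning
  once : ∀ {u} → mult n u ≡ 1 → (countOcc u τ ≡ᵇ 1) ≡ true
  once {u} u∈ = reflects-true (≡ᵇ-reflects-≡ _ 1) (≡.trans (counts perm u) u∈)
  isPerm≡true : isPerm n τ ≡ true
  isPerm≡true = allᵇ-complete (λ v → countOcc v τ ≡ᵇ 1) (All.map once (vals-elements n))

slotIndex : Slot → ℕ
slotIndex fill    = 0
slotIndex attachˡ = 1
slotIndex attachʳ = 2
slotIndex alone   = 3

slotOfIndex : ℕ → Slot
slotOfIndex 0 = fill
slotOfIndex 1 = attachˡ
slotOfIndex 2 = attachʳ
slotOfIndex _ = alone

slotOfIndex-slotIndex : ∀ s → slotOfIndex (slotIndex s) ≡ s
slotOfIndex-slotIndex fill    = refl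
slotOfIndex-slotIndex attachˡ = refl
slotOfIndex-slotIndex attachʳ = refl
slotOfIndex-slotIndex alone   = refl

infix 4 _==ᶜ_
_==ᶜ_ : Choice → Choice → Bool
(g , s) ==ᶜ (g′ , s′) = (g ≡ᵇ g′) ∧ (slotIndex s ≡ᵇ slotIndex s′)

==ᶜ-refl : ∀ c → (c ==ᶜ c) ≡ true
==ᶜ-refl (g , s) rewrite ≡ᵇ-refl g | ≡ᵇ-refl (slotIndex s) = refl

==ᶜ-sound : ∀ c c′ → (c ==ᶜ c′) ≡ true → c ≡ c′
==ᶜ-sound (g , s) (g′ , s′) eq with g ≡ᵇ g′ in g≟g′ | slotIndex s ≡ᵇ slotIndex s′ in s≟s′
... | true | true = cong₂ _,_ (≡ᵇ-sound {g} g≟g′) (begin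
  s                          ≡⟨ ≡.sym (slotOfIndex-slotIndex s) ⟩
  slotOfIndex (slotIndex s)  ≡⟨ cong slotOfIndex (≡ᵇ-sound {slotIndex s} s≟s′) ⟩
  slotOfIndex (slotIndex s′) ≡⟨ slotOfIndex-slotIndex s′ ⟩
  s′                         ∎)
  where open ≡.≡-Reasoning

==ᶜ-reflects : ∀ c c′ → Reflects (c ≡ c′) (c ==ᶜ c′)
==ᶜ-reflects c c′ = Reflects.fromEquivalence (==ᶜ-sound c c′ ∘ Equivalence.to T-≡)
                                              (λ { refl → Equivalence.from T-≡ (==ᶜ-refl c) })

slotsAt : ℕ → List Choice
slotsAt g = (g , fill) ∷ (g , attachˡ) ∷ (g , attachʳ) ∷ (g , alone) ∷ []

choicesUpTo : ℕ → List Choice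
choicesUpTo k = concatMap slotsAt (upTo k)

choicesUpTo-suc : ∀ k → choicesUpTo (suc k) ≡ choicesUpTo k ++ slotsAt k
choicesUpTo-suc k = begin
  concatMap slotsAt (upTo (suc k))          ≡⟨ cong (concatMap slotsAt) (≡.sym (Listₚ.upTo-∷ʳ k)) ⟩
  concatMap slotsAt (upTo k ++ [ k ])       ≡⟨ Listₚ.concatMap-++ slotsAt (upTo k) [ k ] ⟩
  choicesUpTo k ++ slotsAt k ++ []          ≡⟨ cong (choicesUpTo k ++_) (Listₚ.++-identityʳ (slotsAt k)) ⟩
  choicesUpTo k ++ slotsAt k                ∎
  where open ≡.≡-Reasoning

choices : ℕ → List Choice
choices b = choicesUpTo (b ∸ 1)

choices-inRange : ∀ b → All (λ c → suc (proj₁ c) < b) (choices b)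
choices-inRange zero    = []
choices-inRange (suc b) = Allₚ.concat⁺ (Allₚ.map⁺ (All.map slots (Allₚ.all-upTo b)))
  where
  slots : ∀ {g} → g < b → All (λ c → suc (proj₁ c) < suc b) (slotsAt g)
  slots g<b = s≤s g<b ∷ s≤s g<b ∷ s≤s g<b ∷ s≤s g<b ∷ []

choicesUpTo-count : ∀ {A : Set} c₀ k (x : A) → memberships (λ c _ → c₀ ==ᶜ c) (choicesUpTo k) x ≡ ⟦ proj₁ c₀ <ᵇ k ⟧
choicesUpTo-count c₀        zero    x = refl
choicesUpTo-count {A} (g₀ , s₀) (suc k) x = begin
  memberships Q (choicesUpTo (suc k)) x
    ≡⟨ cong (λ cs → memberships Q cs x) (choicesUpTo-suc k) ⟩
  memberships Q (choicesUpTo k ++ slotsAt k) x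
    ≡⟨ memberships-++ Q (choicesUpTo k) (slotsAt k) x ⟩
  memberships Q (choicesUpTo k) x + memberships Q (slotsAt k) x
    ≡⟨ cong₂ _+_ (choicesUpTo-count (g₀ , s₀) k x) (slotsAt-count s₀) ⟩
  ⟦ g₀ <ᵇ k ⟧ + ⟦ g₀ ≡ᵇ k ⟧
    ≡⟨ step ⟩
  ⟦ g₀ <ᵇ suc k ⟧ ∎
  where
  open ≡.≡-Reasoning
  Q : Choice → A → Bool
  Q c _ = (g₀ , s₀) ==ᶜ c
  slotsAt-count : ∀ s₀ → memberships (λ c _ → (g₀ , s₀) ==ᶜ c) (slotsAt k) x ≡ ⟦ g₀ ≡ᵇ k ⟧
  slotsAt-count s₀ with g₀ ≡ᵇ k
  slotsAt-count fill    | true = refl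
  slotsAt-count attachˡ | true = refl
  slotsAt-count attachʳ | true = refl
  slotsAt-count alone   | true = refl
  slotsAt-count s₀      | false = refl
  step : ⟦ g₀ <ᵇ k ⟧ + ⟦ g₀ ≡ᵇ k ⟧ ≡ ⟦ g₀ <ᵇ suc k ⟧
  step with ℕₚ.<-cmp g₀ k
  ... | tri< g₀<k g₀≢k _ rewrite <ᵇ-true g₀<k | ≡ᵇ-false g₀≢k | <ᵇ-true (ℕₚ.m≤n⇒m≤1+n g₀<k) = refl
  ... | tri≈ _ refl _    rewrite <ᵇ-false (ℕₚ.≤-refl {g₀}) | ≡ᵇ-refl g₀ | <ᵇ-true (ℕₚ.n<1+n g₀) = refl
  ... | tri> _ g₀≢k k<g₀ rewrite <ᵇ-false (ℕₚ.<⇒≤ k<g₀) | ≡ᵇ-false g₀≢k | <ᵇ-false {g₀} {suc k} k<g₀ = refl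

choices-count : ∀ {A : Set} c₀ b (x : A) → suc (proj₁ c₀) < b → memberships (λ c _ → c₀ ==ᶜ c) (choices b) x ≡ 1
choices-count c₀ (suc b) x (s≤s g₀<b) = ≡.trans (choicesUpTo-count c₀ b x) (cong ⟦_⟧ (<ᵇ-true g₀<b))

-- The total gap indices of all ways to insert r more values into b blocks, ending with a
-- single block.
insertionStats : ℕ → ℕ → List ℕ
insertionStats zero    zero          = []
insertionStats zero    (suc zero)    = [ 0 ]
insertionStats zero    (suc (suc _)) = []
insertionStats (suc r) b             = concatMap (λ (g , s) → map (g +_) (insertionStats r (blocksAfter s b))) (choices b)

shiftedStats : ℕ → ℕ → Choice → List ℕ
shiftedStats r b (g , s) = map (g +_) (insertionStats r (blocksAfter s b))

blocks-top : ∀ {n σ} → IsPermutation n σ → blocks n σ ≡ [ 0 ∷ σ ++ [ 0 ] ]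
blocks-top {n} {σ} perm = cong (consHead 0) (suffixBlocks-small n σ (permutation-≤ perm))

occAbove-small : ∀ m s → All (_≤ m) s → occAbove m s ≡ 0
occAbove-small m []               _                       = refl
occAbove-small m (a ∷ [])         _                       = refl
occAbove-small m (a ∷ s@(b ∷ rest)) (_ ∷ s≤m@(_ ∷ rest≤m)) =
  cong₂ _+_ (cong length (filterᵇ-none _ rest (All.map not-above rest≤m))) (occAbove-small m s s≤m)
  where
  not-above : ∀ {z} → z ≤ m → strictlyBetween a b z ∧ (m <ᵇ z) ≡ false
  not-above {z} z≤m = ≡.trans (cong (strictlyBetween a b z ∧_) (<ᵇ-false z≤m)) (∧-zeroʳ _)

module InsertionDecomposition (n : ℕ) where

  withBlocks : ℕ → Blocks → List (List ℕ)
  withBlocks m w = filterᵇ (λ σ → blocks m σ ==ᴮ w) (perms n)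

  extendsBy : ℕ → Blocks → Choice → List ℕ → Bool
  extendsBy m w c σ = blocks (suc m) σ ==ᴮ insert (suc m) c w

  module _ {m w σ} (m<n : m < n) (wf : WellFormed m w) (perm : IsPermutation n σ) where
    private
      once : countOcc (suc m) σ ≡ 1
      once = ≡.trans (counts perm (suc m)) (cong ⟦_⟧ (<ᵇ-true m<n))

      recovers : ∀ c → InRange c w → insert (suc m) (insertionChoice m σ) (blocks m σ) ≡ insert (suc m) c w →
                 insertionChoice m σ ≡ c × blocks m σ ≡ w
      recovers c in-range = insert-injective (suc m)
        (WellFormed⇒Avoids m _ (blocks-wellFormed σ (ℕₚ.<⇒≤ m<n) perm)) (blocks-inRange m σ once)
        (WellFormed⇒Avoids m w wf) in-range

    extendsBy-iff : ∀ c → InRange c w → extendsBy m w c σ ≡ (insertionChoice m σ ==ᶜ c) ∧ (blocks m σ ==ᴮ w)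
    extendsBy-iff c in-range = ≡.trans (cong (_==ᴮ insert (suc m) c w) (blocks-suc m σ once))
      (reflects-≡ (proof (_ ≟ᴮ _))
                  (==ᶜ-reflects _ c ×-reflects proof (_ ≟ᴮ w))
                  (recovers c in-range) (λ { (refl , refl) → refl }))

    memberships-extendsBy : memberships (extendsBy m w) (choices (length w)) σ ≡ ⟦ blocks m σ ==ᴮ w ⟧
    memberships-extendsBy =
      ≡.trans (memberships-cong (choices (length w)) σ (All.map (λ {c} → extendsBy-iff c) (choices-inRange (length w))))
              (by-blocks (blocks m σ ==ᴮ w) refl)
      where
      by-blocks : ∀ b → (blocks m σ ==ᴮ w) ≡ b →
                  memberships (λ c _ → (insertionChoice m σ ==ᶜ c) ∧ b) (choices (length w)) σ ≡ ⟦ b ⟧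
      by-blocks false _ = memberships-none _ (choices (length w)) σ (λ c → ∧-zeroʳ _)
      by-blocks true  same with refl ← does-sound (blocks m σ ≟ᴮ w) same =
        ≡.trans (memberships-cong (choices (length w)) σ (All.tabulate (λ _ → ∧-identityʳ _)))
                (choices-count (insertionChoice m σ) (length w) σ (blocks-inRange m σ once))

    occAbove-extendsBy : ∀ c → InRange c w → extendsBy m w c σ ≡ true → occAbove m σ ≡ proj₁ c + occAbove (suc m) σ
    occAbove-extendsBy c in-range extends
      with refl , _ ← recovers c in-range (≡.trans (≡.sym (blocks-suc m σ once)) (does-sound (_ ≟ᴮ _) extends))
      = ≡.trans (occAbove-split m σ) (cong (_+ occAbove (suc m) σ) (occAt≡insertionGap m σ once))

  withBlocks-nonSingleton : ∀ {w} → (∀ {X} → [ X ] ≢ w) → withBlocks n w ≡ []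
  withBlocks-nonSingleton {w} not-single = filterᵇ-none _ (perms n) (All.map
    (λ {σ} perm → dec-false (blocks n σ ≟ᴮ w) (not-single ∘ ≡.trans (≡.sym (blocks-top perm))))
    (perms-permutation n))

  withBlocks-top : ∀ w → WellFormed n w → map (occAbove n) (withBlocks n w) ↭ insertionStats 0 (length w)
  withBlocks-top []           _ = ↭-reflexive (cong (map (occAbove n)) (withBlocks-nonSingleton λ ()))
  withBlocks-top (X ∷ Y ∷ Ws) _ = ↭-reflexive (cong (map (occAbove n)) (withBlocks-nonSingleton λ ()))
  withBlocks-top (X ∷ []) (_ , τ , concat≡ , τ-perm) = ↭-reflexive (begin
    map (occAbove n) (filterᵇ (λ σ → blocks n σ ==ᴮ [ X ]) (perms n))
      ≡⟨ cong (map (occAbove n)) (filterᵇ-cong (perms n) (All.map same-block (perms-permutation n))) ⟩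
    map (occAbove n) (filterᵇ (_==ᴸ τ) (perms n))
      ≡⟨ cong (map (occAbove n)) (perms-unique n τ τ-perm) ⟩
    [ occAbove n τ ]
      ≡⟨ cong [_] (occAbove-small n τ (permutation-≤ τ-perm)) ⟩
    [ 0 ] ∎)
    where
    open ≡.≡-Reasoning
    X≡ : X ≡ 0 ∷ τ ++ [ 0 ]
    X≡ = ≡.trans (≡.sym (Listₚ.++-identityʳ X)) concat≡
    same-block : ∀ {σ} → IsPermutation n σ → (blocks n σ ==ᴮ [ X ]) ≡ (σ ==ᴸ τ)
    same-block {σ} perm rewrite blocks-top perm | X≡ =
      does-⇔ (mk⇔ unwrap (cong (λ τ → [ 0 ∷ τ ++ [ 0 ] ]))) ([ 0 ∷ σ ++ [ 0 ] ] ≟ᴮ [ 0 ∷ τ ++ [ 0 ] ]) (σ ≟ᴸ τ)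
      where
      unwrap : [ 0 ∷ σ ++ [ 0 ] ] ≡ [ 0 ∷ τ ++ [ 0 ] ] → σ ≡ τ
      unwrap eq = Listₚ.++-cancelʳ [ 0 ] σ τ (Listₚ.∷-injectiveʳ (Listₚ.∷-injectiveˡ eq))

  -- The permutations with blocks m σ ≡ w split according to the choice c by which m + 1 is
  -- inserted; the class of c is withBlocks (suc m) (insert (suc m) c w), and on it occAbove m
  -- exceeds occAbove (suc m) by the gap index of c.
  withBlocks-stats : ∀ r m w → r + m ≡ n → WellFormed m w → map (occAbove m) (withBlocks m w) ↭ insertionStats r (length w)
  withBlocks-stats zero    m w refl wf = withBlocks-top w wf
  withBlocks-stats (suc r) m w r+m≡n wf = begin
    map (occAbove m) (withBlocks m w)
      ↭⟨ ↭ₚ.map⁺ (occAbove m) (filterᵇ-↭-partition (extendsBy m w) (λ σ → blocks m σ ==ᴮ w) cs (perms n)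
                                (All.map (memberships-extendsBy m<n wf) (perms-permutation n))) ⟩
    map (occAbove m) (concatMap (λ c → withBlocks (suc m) (insert (suc m) c w)) cs)
      ≡⟨ Listₚ.map-concatMap (occAbove m) _ cs ⟩
    concatMap (λ c → map (occAbove m) (withBlocks (suc m) (insert (suc m) c w))) cs
      ↭⟨ concatMap-↭ (All.map (λ {c} → extension c) (choices-inRange (length w))) ⟩
    insertionStats (suc r) (length w) ∎
    where
    open PermutationReasoning
    cs = choices (length w)
    m<n : m < n
    m<n = ≡.subst (m <_) r+m≡n (ℕₚ.m<n+m m (s≤s z≤n))
    extension : ∀ c → InRange c w → map (occAbove m) (withBlocks (suc m) (insert (suc m) c w)) ↭
                                     map (proj₁ c +_) (insertionStats r (blocksAfter (proj₂ c) (length w)))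
    extension c in-range = begin
      map (occAbove m) (withBlocks (suc m) (insert (suc m) c w))
        ≡⟨ Listₚ.map-cong-local (All.map (λ (perm , extends) → occAbove-extendsBy m<n wf perm c in-range extends)
             (filterᵇ-All (extendsBy m w c) (perms-permutation n))) ⟩
      map ((proj₁ c +_) ∘ occAbove (suc m)) (withBlocks (suc m) (insert (suc m) c w))
        ≡⟨ Listₚ.map-∘ (withBlocks (suc m) (insert (suc m) c w)) ⟩
      map (proj₁ c +_) (map (occAbove (suc m)) (withBlocks (suc m) (insert (suc m) c w)))
        ↭⟨ ↭ₚ.map⁺ (proj₁ c +_) (withBlocks-stats r (suc m) (insert (suc m) c w) (≡.trans (ℕₚ.+-suc r m) r+m≡n)
                                                  (insert-wellFormed m c w in-range wf)) ⟩
      map (proj₁ c +_) (insertionStats r (length (insert (suc m) c w)))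
        ≡⟨ cong (map (proj₁ c +_) ∘ insertionStats r) (length-insert (suc m) c w in-range) ⟩
      map (proj₁ c +_) (insertionStats r (blocksAfter (proj₂ c) (length w))) ∎

pairCount : ℕ → (ℕ → ℕ → Bool) → ℕ
pairCount n P = ∑ℕ.∑ n (λ i → ∑ℕ.∑ n (λ j → ⟦ P i j ⟧))

countPairs≡pairCount : ∀ n P → countPairs n P ≡ pairCount n P
countPairs≡pairCount n P = ≡.trans (sumℕ≡∑ n _) (∑ℕ.∑-cong n (λ i → sumℕ≡∑ n _))

is31-2 : List ℕ → ℕ → ℕ → Bool
is31-2 σ i k = (suc i <ᵇ k) ∧ (at σ (suc i) <ᵇ at σ k) ∧ (at σ k <ᵇ at σ i)

∑-at≡length-filterᵇ : ∀ (p : ℕ → Bool) xs → ∑ℕ.∑ (length xs) (λ k → ⟦ p (at xs k) ⟧) ≡ length (filterᵇ p xs)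
∑-at≡length-filterᵇ p []       = refl
∑-at≡length-filterᵇ p (z ∷ xs) = begin
  ∑ℕ.∑ (suc (length xs)) (λ k → ⟦ p (at (z ∷ xs) k) ⟧)   ≡⟨ ∑ℕ.∑-unfoldˡ (length xs) _ ⟩
  ⟦ p z ⟧ + ∑ℕ.∑ (length xs) (λ k → ⟦ p (at xs k) ⟧)     ≡⟨ cong (⟦ p z ⟧ +_) (∑-at≡length-filterᵇ p xs) ⟩
  ⟦ p z ⟧ + length (filterᵇ p xs)                         ≡⟨ ≡.sym (length-filterᵇ-cons p z xs) ⟩
  length (filterᵇ p (z ∷ xs))                             ∎
  where open ≡.≡-Reasoning

pairCount-31-2≡occAbove : ∀ σ → pairCount (length σ) (is31-2 σ) ≡ occAbove 0 σ
pairCount-31-2≡occAbove []       = refl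
pairCount-31-2≡occAbove (a ∷ []) = refl
pairCount-31-2≡occAbove (a ∷ σ@(b ∷ rest)) = begin
  pairCount (suc L) (is31-2 (a ∷ σ))
    ≡⟨ ∑ℕ.∑-unfoldˡ L _ ⟩
  ∑ℕ.∑ (suc L) (λ k → ⟦ is31-2 (a ∷ σ) 0 k ⟧) + ∑ℕ.∑ L (λ i → ∑ℕ.∑ (suc L) (λ k → ⟦ is31-2 (a ∷ σ) (suc i) k ⟧))
    ≡⟨ cong₂ _+_ firstRow (∑ℕ.∑-cong L (λ i → ∑ℕ.∑-unfoldˡ L _)) ⟩
  length (filterᵇ (λ z → strictlyBetween a b z ∧ (0 <ᵇ z)) rest) + pairCount L (is31-2 σ)
    ≡⟨ cong (length (filterᵇ (λ z → strictlyBetween a b z ∧ (0 <ᵇ z)) rest) +_) (pairCount-31-2≡occAbove σ) ⟩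
  occAbove 0 (a ∷ σ) ∎
  where
  open ≡.≡-Reasoning
  L = length σ
  positive : ∀ z → strictlyBetween a b z ≡ strictlyBetween a b z ∧ (0 <ᵇ z)
  positive zero    = cong (_∧ (0 <ᵇ a)) (<ᵇ-false {b} z≤n)
  positive (suc z) = ≡.sym (∧-identityʳ _)
  firstRow : ∑ℕ.∑ (suc L) (λ k → ⟦ is31-2 (a ∷ σ) 0 k ⟧) ≡ length (filterᵇ (λ z → strictlyBetween a b z ∧ (0 <ᵇ z)) rest)
  firstRow = begin
    ∑ℕ.∑ (suc (suc (length rest))) (λ k → ⟦ is31-2 (a ∷ σ) 0 k ⟧)
      ≡⟨ ≡.trans (∑ℕ.∑-unfoldˡ (suc (length rest)) _) (∑ℕ.∑-unfoldˡ (length rest) _) ⟩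
    ∑ℕ.∑ (length rest) (λ k → ⟦ strictlyBetween a b (at rest k) ⟧)
      ≡⟨ ∑-at≡length-filterᵇ (strictlyBetween a b) rest ⟩
    length (filterᵇ (strictlyBetween a b) rest)
      ≡⟨ cong length (filterᵇ-≗ positive rest) ⟩
    length (filterᵇ (λ z → strictlyBetween a b z ∧ (0 <ᵇ z)) rest) ∎

occ31-2≡occAbove : ∀ σ → occ p31-2 σ ≡ occAbove 0 σ
occ31-2≡occAbove σ = ≡.trans (countPairs≡pairCount (length σ) (is31-2 σ)) (pairCount-31-2≡occAbove σ)

initialBlocks : Blocks
initialBlocks = [ 0 ] ∷ [ 0 ] ∷ []

initialBlocks-wellFormed : WellFormed 0 initialBlocks
initialBlocks-wellFormed = tt ∷ tt ∷ [] , [] , refl , isPermutation λ { zero → refl ; (suc u) → refl }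

blocks-bottom : ∀ {n σ} → 1 ≤ n → IsPermutation n σ → blocks 0 σ ≡ initialBlocks
blocks-bottom {n} {[]}    1≤n perm with () ← ≡.trans (counts perm 1) (cong ⟦_⟧ (<ᵇ-true 1≤n))
blocks-bottom {n} {x ∷ σ} 1≤n perm =
  cong (consHead 0) (suffixBlocks-zero x σ (All.map (λ {y} → mult≡1⇒positive y) (permutation-elements perm)))

perms-occAbove : ∀ n → 1 ≤ n → map (occAbove 0) (perms n) ↭ insertionStats n 2
perms-occAbove n 1≤n = ≡.subst (λ σs → map (occAbove 0) σs ↭ insertionStats n 2) all-initial
  (withBlocks-stats n 0 initialBlocks (ℕₚ.+-identityʳ n) initialBlocks-wellFormed)
  where
  open InsertionDecomposition n
  all-initial : withBlocks 0 initialBlocks ≡ perms n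
  all-initial = filterᵇ-all _ (All.map (λ {σ} perm → dec-true (blocks 0 σ ≟ᴮ initialBlocks) (blocks-bottom 1≤n perm))
                                       (perms-permutation n))

module ListMultiplicity = Multiplicity _==ᴸ_ (λ xs ys → proof (xs ≟ᴸ ys))

module PermsInvariance (n : ℕ) (φ : List ℕ → List ℕ) (φ-involutive : ∀ σ → φ (φ σ) ≡ σ)
                       (φ-permutation : ∀ {σ} → IsPermutation n σ → IsPermutation n (φ σ)) where

  copies : List ℕ → List (List ℕ)
  copies τ = filterᵇ (_==ᴸ τ) (perms n)

  copies-absent-or-permutation : ∀ τ → length (copies τ) ≡ 0 ⊎ IsPermutation n τ
  copies-absent-or-permutation τ with copies τ | filterᵇ-All (_==ᴸ τ) (perms-permutation n)
  ... | []     | _                   = inj₁ refl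
  ... | σ ∷ _  | (σ-perm , σ≡τ) ∷ _ = inj₂ (≡.subst (IsPermutation n) (does-sound (σ ≟ᴸ τ) σ≡τ) σ-perm)

  length-copies-φ : ∀ τ → length (copies (φ τ)) ≡ length (copies τ)
  length-copies-φ τ with copies-absent-or-permutation τ | copies-absent-or-permutation (φ τ)
  ... | inj₂ τ-perm | _ =
    ≡.trans (cong length (perms-unique n (φ τ) (φ-permutation τ-perm))) (≡.sym (cong length (perms-unique n τ τ-perm)))
  ... | inj₁ none | inj₁ none′ = ≡.trans none′ (≡.sym none)
  ... | inj₁ none | inj₂ φτ-perm
    with () ← ≡.trans (≡.sym (cong length (perms-unique n τ (≡.subst (IsPermutation n) (φ-involutive τ) (φ-permutation φτ-perm))))) none

  map-φ-perms : map φ (perms n) ↭ perms n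
  map-φ-perms = ListMultiplicity.multiplicity-≗⇒↭ (map φ (perms n)) (perms n) λ τ → begin
    length (filterᵇ (_==ᴸ τ) (map φ (perms n)))       ≡⟨ length-filterᵇ-map (_==ᴸ τ) φ (perms n) ⟩
    length (filterᵇ (λ σ → φ σ ==ᴸ τ) (perms n))      ≡⟨ cong length (filterᵇ-≗ (λ σ → φ-swap σ τ) (perms n)) ⟩
    length (copies (φ τ))                              ≡⟨ length-copies-φ τ ⟩
    length (copies τ)                                  ∎
    where
    open ≡.≡-Reasoning
    φ-swap : ∀ σ τ → (φ σ ==ᴸ τ) ≡ (σ ==ᴸ φ τ)
    φ-swap σ τ = does-⇔ (mk⇔ (λ { refl → ≡.sym (φ-involutive σ) }) (λ { refl → φ-involutive τ }))
                        (φ σ ≟ᴸ τ) (σ ≟ᴸ φ τ)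

map-transport-↭ : ∀ n (φ : List ℕ → List ℕ) (f g : List ℕ → ℕ) → map φ (perms n) ↭ perms n →
               All (λ σ → f (φ σ) ≡ g σ) (perms n) → map f (perms n) ↭ map g (perms n)
map-transport-↭ n φ f g map-φ f∘φ≗g = ↭-trans (↭ₚ.map⁺ f (↭-sym map-φ))
  (↭-reflexive (≡.trans (≡.sym (Listₚ.map-∘ (perms n))) (Listₚ.map-cong-local f∘φ≗g)))

at-++ˡ : ∀ (ys zs : List ℕ) j → j < length ys → at (ys ++ zs) j ≡ at ys j
at-++ˡ (y ∷ ys) zs zero    _         = refl
at-++ˡ (y ∷ ys) zs (suc j) (s≤s j<n) = at-++ˡ ys zs j j<n

at-++ʳ : ∀ (ys zs : List ℕ) → at (ys ++ zs) (length ys) ≡ at zs 0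
at-++ʳ []       zs = refl
at-++ʳ (y ∷ ys) zs = at-++ʳ ys zs

at-reverse : ∀ σ j → j < length σ → at (reverse σ) j ≡ at σ (length σ ∸ suc j)
at-reverse (x ∷ xs) j (s≤s j≤n) rewrite Listₚ.unfold-reverse x xs with ℕₚ.m≤n⇒m<n∨m≡n j≤n
... | inj₁ j<n = begin
  at (reverse xs ++ [ x ]) j          ≡⟨ at-++ˡ (reverse xs) [ x ] j (≡.subst (j <_) (≡.sym (Listₚ.length-reverse xs)) j<n) ⟩
  at (reverse xs) j                   ≡⟨ at-reverse xs j j<n ⟩
  at xs (length xs ∸ suc j)           ≡⟨ cong (at (x ∷ xs)) (≡.sym (ℕₚ.+-∸-assoc 1 j<n)) ⟩
  at (x ∷ xs) (length xs ∸ j)         ∎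
  where open ≡.≡-Reasoning
... | inj₂ refl = begin
  at (reverse xs ++ [ x ]) (length xs)              ≡⟨ cong (at (reverse xs ++ [ x ])) (≡.sym (Listₚ.length-reverse xs)) ⟩
  at (reverse xs ++ [ x ]) (length (reverse xs))    ≡⟨ at-++ʳ (reverse xs) [ x ] ⟩
  x                                                 ≡⟨ cong (at (x ∷ xs)) (≡.sym (ℕₚ.n∸n≡0 (length xs))) ⟩
  at (x ∷ xs) (length xs ∸ length xs)               ∎
  where open ≡.≡-Reasoning

at-map : ∀ (f : ℕ → ℕ) σ i → i < length σ → at (map f σ) i ≡ f (at σ i)
at-map f (x ∷ σ) zero    _         = refl
at-map f (x ∷ σ) (suc i) (s≤s i<n) = at-map f σ i i<n

All-at : ∀ {P : ℕ → Set} σ i → All P σ → i < length σ → P (at σ i)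
All-at (x ∷ σ) zero    (px ∷ _)  _         = px
All-at (x ∷ σ) (suc i) (_ ∷ pxs) (s≤s i<n) = All-at σ i pxs i<n

pairCount-cong : ∀ L P P′ → (∀ i j → i < L → j < L → P i j ≡ P′ i j) → pairCount L P ≡ pairCount L P′
pairCount-cong L P P′ P≗P′ = ∑ℕ.∑-cong-< L (λ i i<L → ∑ℕ.∑-cong-< L (λ j j<L → cong ⟦_⟧ (P≗P′ i j i<L j<L)))

∸-<ᵇ-∸ : ∀ N x y → x ≤ N → y ≤ N → ((N ∸ x) <ᵇ (N ∸ y)) ≡ (y <ᵇ x)
∸-<ᵇ-∸ N x y x≤N y≤N with ℕₚ.<-cmp y x
... | tri< y<x _ _ = ≡.trans (<ᵇ-true (ℕₚ.∸-monoʳ-< y<x x≤N)) (≡.sym (<ᵇ-true y<x))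
... | tri≈ _ refl _ = ≡.trans (<ᵇ-false (ℕₚ.≤-refl {N ∸ x})) (≡.sym (<ᵇ-false (ℕₚ.≤-refl {x})))
... | tri> _ _ x<y = ≡.trans (<ᵇ-false (ℕₚ.∸-monoʳ-≤ N (ℕₚ.<⇒≤ x<y))) (≡.sym (<ᵇ-false (ℕₚ.<⇒≤ x<y)))

is2-13 : List ℕ → ℕ → ℕ → Bool
is2-13 ρ i j = (i <ᵇ j) ∧ (suc j <ᵇ length ρ) ∧ (at ρ j <ᵇ at ρ i) ∧ (at ρ i <ᵇ at ρ (suc j))

module _ (x : ℕ) (xs : List ℕ) where
  private
    σ  = x ∷ xs
    ρ  = reverse σ
    n′ = length xs
    open ∑ℕ using (∑)

    length-ρ : length ρ ≡ suc n′
    length-ρ = Listₚ.length-reverse σ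

    at-ρ : ∀ j → j ≤ n′ → at ρ j ≡ at σ (n′ ∸ j)
    at-ρ j j≤n′ = at-reverse σ j (s≤s j≤n′)

  is2-13-reverse : ∀ a b → a < n′ → b ≤ n′ → is2-13 ρ (n′ ∸ b) (n′ ∸ suc a) ≡ is31-2 σ a b
  is2-13-reverse a b a<n′ b≤n′
    rewrite length-ρ
          | ∸-<ᵇ-∸ n′ b (suc a) b≤n′ a<n′
          | <ᵇ-true {n′ ∸ suc a} {n′} (ℕₚ.∸-monoʳ-< {o = 0} (s≤s z≤n) a<n′)
          | at-ρ (n′ ∸ suc a) (ℕₚ.m∸n≤m n′ (suc a)) | ℕₚ.m∸[m∸n]≡n a<n′
          | at-ρ (n′ ∸ b) (ℕₚ.m∸n≤m n′ b) | ℕₚ.m∸[m∸n]≡n b≤n′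
          | ≡.sym (ℕₚ.+-∸-assoc 1 a<n′)
          | at-ρ (n′ ∸ a) (ℕₚ.m∸n≤m n′ a) | ℕₚ.m∸[m∸n]≡n (ℕₚ.<⇒≤ a<n′) = refl

  pairCount-2-13-reverse : pairCount (suc n′) (is2-13 ρ) ≡ pairCount (suc n′) (is31-2 σ)
  pairCount-2-13-reverse = begin
    ∑ (suc n′) (λ i → ∑ (suc n′) (λ j → ⟦ is2-13 ρ i j ⟧))
      ≡⟨ ∑ℕ.∑-swap (suc n′) (suc n′) (λ i j → ⟦ is2-13 ρ i j ⟧) ⟩
    ∑ (suc n′) (λ j → ∑ (suc n′) (λ i → ⟦ is2-13 ρ i j ⟧))
      ≡⟨ ∑ℕ.∑-cong (suc n′) (λ j → ∑ℕ.∑-reverse (suc n′) _) ⟩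
    ∑ (suc n′) column
      ≡⟨ ∑ℕ.∑-reverse (suc n′) column ⟩
    ∑ (suc n′) (λ a → column (n′ ∸ a))
      ≡⟨ ∑ℕ.∑-unfoldˡ n′ _ ⟩
    column n′ + ∑ n′ (λ a → column (n′ ∸ suc a))
      ≡⟨ cong₂ _+_ lastColumn (∑ℕ.∑-cong-< n′ (λ a a<n′ → ∑ℕ.∑-cong-< (suc n′) (λ b b<1+n′ →
           cong ⟦_⟧ (is2-13-reverse a b a<n′ (ℕₚ.≤-pred b<1+n′))))) ⟩
    ∑ n′ (λ a → ∑ (suc n′) (λ b → ⟦ is31-2 σ a b ⟧))
      ≡⟨ ≡.sym (ℕₚ.+-identityʳ _) ⟩
    ∑ n′ (λ a → ∑ (suc n′) (λ b → ⟦ is31-2 σ a b ⟧)) + 0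
      ≡⟨ cong (∑ n′ (λ a → ∑ (suc n′) (λ b → ⟦ is31-2 σ a b ⟧)) +_) (≡.sym lastRow) ⟩
    ∑ (suc n′) (λ a → ∑ (suc n′) (λ b → ⟦ is31-2 σ a b ⟧)) ∎
    where
    open ≡.≡-Reasoning
    column : ℕ → ℕ
    column j = ∑ (suc n′) (λ b → ⟦ is2-13 ρ (n′ ∸ b) j ⟧)
    values : ℕ → Bool
    values b = (at ρ n′ <ᵇ at ρ (n′ ∸ b)) ∧ (at ρ (n′ ∸ b) <ᵇ at ρ (suc n′))
    lastColumn : column n′ ≡ 0
    lastColumn = ∑ℕ.∑-zero (suc n′) (λ b _ → cong ⟦_⟧
      (≡.trans (cong (λ L → ((n′ ∸ b) <ᵇ n′) ∧ (suc n′ <ᵇ L) ∧ values b) length-ρ)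
               (≡.trans (cong (λ c → ((n′ ∸ b) <ᵇ n′) ∧ c ∧ values b) (<ᵇ-false (ℕₚ.≤-refl {suc n′}))) (∧-zeroʳ _))))
    lastRow : ∑ (suc n′) (λ b → ⟦ is31-2 σ n′ b ⟧) ≡ 0
    lastRow = ∑ℕ.∑-zero (suc n′) (λ b b<1+n′ →
      cong ⟦_⟧ (cong (_∧ ((at σ (suc n′) <ᵇ at σ b) ∧ (at σ b <ᵇ at σ n′))) (<ᵇ-false {suc n′} {b} (ℕₚ.<⇒≤ b<1+n′))))

occ2-13-reverse : ∀ σ → occ p2-13 (reverse σ) ≡ occ p31-2 σ
occ2-13-reverse []         = refl
occ2-13-reverse σ@(x ∷ xs) = begin
  countPairs (length (reverse σ)) (is2-13 (reverse σ))   ≡⟨ countPairs≡pairCount (length (reverse σ)) (is2-13 (reverse σ)) ⟩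
  pairCount (length (reverse σ)) (is2-13 (reverse σ))    ≡⟨ cong (λ L → pairCount L (is2-13 (reverse σ))) (Listₚ.length-reverse σ) ⟩
  pairCount (length σ) (is2-13 (reverse σ))              ≡⟨ pairCount-2-13-reverse x xs ⟩
  pairCount (length σ) (is31-2 σ)                        ≡⟨ ≡.sym (countPairs≡pairCount (length σ) (is31-2 σ)) ⟩
  occ p31-2 σ                                            ∎
  where open ≡.≡-Reasoning

complement : ℕ → ℕ → ℕ
complement n zero    = zero
complement n (suc x) = if x <ᵇ n then n ∸ x else suc x

complement-inside : ∀ n x → x ≤ n → complement (suc n) (suc x) ≡ suc (n ∸ x)
complement-inside n x x≤n rewrite <ᵇ-true {x} {suc n} (s≤s x≤n) = ℕₚ.+-∸-assoc 1 x≤n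

complement-outside : ∀ n x → n ≤ x → complement n (suc x) ≡ suc x
complement-outside n x n≤x rewrite <ᵇ-false {x} {n} n≤x = refl

complement-involutive : ∀ n y → complement n (complement n y) ≡ y
complement-involutive n zero    = refl
complement-involutive n (suc x) with ℕₚ.≤-<-connex n x
... | inj₁ n≤x = ≡.trans (cong (complement n) (complement-outside n x n≤x)) (complement-outside n x n≤x)
complement-involutive (suc n) (suc x) | inj₂ (s≤s x≤n) = begin
  complement (suc n) (complement (suc n) (suc x))   ≡⟨ cong (complement (suc n)) (complement-inside n x x≤n) ⟩
  complement (suc n) (suc (n ∸ x))                  ≡⟨ complement-inside n (n ∸ x) (ℕₚ.m∸n≤m n x) ⟩
  suc (n ∸ (n ∸ x))                                 ≡⟨ cong suc (ℕₚ.m∸[m∸n]≡n x≤n) ⟩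
  suc x                                             ∎
  where open ≡.≡-Reasoning

complement-mult : ∀ n u → mult n (complement n u) ≡ mult n u
complement-mult n zero    = refl
complement-mult n (suc x) with ℕₚ.≤-<-connex n x
... | inj₁ n≤x = cong (mult n) (complement-outside n x n≤x)
complement-mult (suc n) (suc x) | inj₂ (s≤s x≤n) = begin
  mult (suc n) (complement (suc n) (suc x))   ≡⟨ cong (mult (suc n)) (complement-inside n x x≤n) ⟩
  ⟦ n ∸ x <ᵇ suc n ⟧                          ≡⟨ cong ⟦_⟧ (<ᵇ-true (s≤s (ℕₚ.m∸n≤m n x))) ⟩
  1                                           ≡⟨ cong ⟦_⟧ (≡.sym (<ᵇ-true (s≤s x≤n))) ⟩
  ⟦ x <ᵇ suc n ⟧                              ∎
  where open ≡.≡-Reasoning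

complement-permutation : ∀ n {τ} → IsPermutation n τ → IsPermutation n (map (complement n) τ)
complement-permutation n {τ} perm .counts u = begin
  length (filterᵇ (_≡ᵇ u) (map (complement n) τ))           ≡⟨ length-filterᵇ-map (_≡ᵇ u) (complement n) τ ⟩
  length (filterᵇ (λ x → complement n x ≡ᵇ u) τ)            ≡⟨ cong length (filterᵇ-≗ swap τ) ⟩
  countOcc (complement n u) τ                                ≡⟨ counts perm (complement n u) ⟩
  mult n (complement n u)                                    ≡⟨ complement-mult n u ⟩
  mult n u                                                   ∎
  where
  open ≡.≡-Reasoning
  swap : ∀ x → (complement n x ≡ᵇ u) ≡ (x ≡ᵇ complement n u)
  swap x = does-⇔ (mk⇔ (λ { refl → ≡.sym (complement-involutive n x) }) (λ { refl → complement-involutive n u }))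
                  (complement n x ℕₚ.≟ u) (x ℕₚ.≟ complement n u)

complement-<ᵇ : ∀ n a b → mult n a ≡ 1 → mult n b ≡ 1 → (complement n a <ᵇ complement n b) ≡ (b <ᵇ a)
complement-<ᵇ (suc n) (suc a) (suc b) a∈ b∈ =
  inside (ℕₚ.≤-pred (mult≡1⇒≤ (suc a) a∈)) (ℕₚ.≤-pred (mult≡1⇒≤ (suc b) b∈))
  where
  inside : a ≤ n → b ≤ n → (complement (suc n) (suc a) <ᵇ complement (suc n) (suc b)) ≡ (suc b <ᵇ suc a)
  inside a≤n b≤n rewrite complement-inside n a a≤n | complement-inside n b b≤n = ∸-<ᵇ-∸ n a b a≤n b≤n

module _ (n : ℕ) {σ} (perm : IsPermutation n σ) where
  private
    c = complement n
    ρ = map c σ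
    L = length σ
    elements = permutation-elements perm
    at-ρ : ∀ i → i < L → at ρ i ≡ c (at σ i)
    at-ρ = at-map c σ
    flip : ∀ i j → i < L → j < L → (at ρ i <ᵇ at ρ j) ≡ (at σ j <ᵇ at σ i)
    flip i j i<L j<L rewrite at-ρ i i<L | at-ρ j j<L =
      complement-<ᵇ n (at σ i) (at σ j) (All-at σ i elements i<L) (All-at σ j elements j<L)

  occ2-31-complement : occ p2-31 (map (complement n) σ) ≡ occ p2-13 σ
  occ2-31-complement = begin
    countPairs (length ρ) (is2-31 (length ρ))   ≡⟨ countPairs≡pairCount (length ρ) (is2-31 (length ρ)) ⟩
    pairCount (length ρ) (is2-31 (length ρ))    ≡⟨ cong (λ M → pairCount M (is2-31 M)) (Listₚ.length-map c σ) ⟩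
    pairCount L (is2-31 L)                      ≡⟨ pairCount-cong L (is2-31 L) (is2-13 σ) pointwise ⟩
    pairCount L (is2-13 σ)                      ≡⟨ ≡.sym (countPairs≡pairCount L (is2-13 σ)) ⟩
    occ p2-13 σ                                 ∎
    where
    open ≡.≡-Reasoning
    is2-31 : ℕ → ℕ → ℕ → Bool
    is2-31 M i j = (i <ᵇ j) ∧ (suc j <ᵇ M) ∧ (at ρ (suc j) <ᵇ at ρ i) ∧ (at ρ i <ᵇ at ρ j)
    pointwise : ∀ i j → i < L → j < L → is2-31 L i j ≡ is2-13 σ i j
    pointwise i j i<L j<L with suc j <ᵇ L in 1+j<ᵇL
    ... | false = refl
    ... | true rewrite flip (suc j) i (<ᵇ-sound 1+j<ᵇL) i<L | flip i j i<L j<L =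
      cong ((i <ᵇ j) ∧_) (∧-comm (at σ i <ᵇ at σ (suc j)) (at σ j <ᵇ at σ i))

  occ13-2-complement : occ p13-2 (map (complement n) σ) ≡ occ p31-2 σ
  occ13-2-complement = begin
    countPairs (length ρ) is13-2   ≡⟨ countPairs≡pairCount (length ρ) is13-2 ⟩
    pairCount (length ρ) is13-2    ≡⟨ cong (λ M → pairCount M is13-2) (Listₚ.length-map c σ) ⟩
    pairCount L is13-2             ≡⟨ pairCount-cong L is13-2 (is31-2 σ) pointwise ⟩
    pairCount L (is31-2 σ)         ≡⟨ ≡.sym (countPairs≡pairCount L (is31-2 σ)) ⟩
    occ p31-2 σ                    ∎
    where
    open ≡.≡-Reasoning
    is13-2 : ℕ → ℕ → Bool
    is13-2 i k = (suc i <ᵇ k) ∧ (at ρ i <ᵇ at ρ k) ∧ (at ρ k <ᵇ at ρ (suc i))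
    pointwise : ∀ i k → i < L → k < L → is13-2 i k ≡ is31-2 σ i k
    pointwise i k i<L k<L with suc i <ᵇ k in 1+i<ᵇk
    ... | false = refl
    ... | true rewrite flip i k i<L k<L | flip k (suc i) k<L (ℕₚ.<-trans (<ᵇ-sound 1+i<ᵇk) k<L) =
      ∧-comm (at σ k <ᵇ at σ i) (at σ (suc i) <ᵇ at σ k)

reverse-permutation : ∀ n {τ} → IsPermutation n τ → IsPermutation n (reverse τ)
reverse-permutation n {τ} perm .counts u = ≡.trans (countOcc-↭ u (↭ₚ.↭-reverse τ)) (counts perm u)

map-complement-involutive : ∀ n σ → map (complement n) (map (complement n) σ) ≡ σ
map-complement-involutive n σ =
  ≡.trans (≡.sym (Listₚ.map-∘ σ)) (≡.trans (Listₚ.map-cong (complement-involutive n) σ) (Listₚ.map-id σ))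

module _ (n : ℕ) (1≤n : 1 ≤ n) where

  private
    reverse-perms : map reverse (perms n) ↭ perms n
    reverse-perms = PermsInvariance.map-φ-perms n reverse Listₚ.reverse-involutive (reverse-permutation n)

    complement-perms : map (map (complement n)) (perms n) ↭ perms n
    complement-perms = PermsInvariance.map-φ-perms n (map (complement n)) (map-complement-involutive n)
                                                   (complement-permutation n)

  perms-stats-31-2 : map (occ p31-2) (perms n) ↭ insertionStats n 2
  perms-stats-31-2 =
    ≡.subst (_↭ insertionStats n 2) (Listₚ.map-cong (≡.sym ∘ occ31-2≡occAbove) (perms n)) (perms-occAbove n 1≤n)

  perms-stats-2-13 : map (occ p2-13) (perms n) ↭ insertionStats n 2
  perms-stats-2-13 = ↭-trans
    (map-transport-↭ n reverse (occ p2-13) (occ p31-2) reverse-perms (All.tabulate (λ {σ} _ → occ2-13-reverse σ)))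
    perms-stats-31-2

  perms-stats-2-31 : map (occ p2-31) (perms n) ↭ insertionStats n 2
  perms-stats-2-31 = ↭-trans
    (map-transport-↭ n (map (complement n)) (occ p2-31) (occ p2-13) complement-perms
                  (All.map (occ2-31-complement n) (perms-permutation n)))
    perms-stats-2-13

  perms-stats-13-2 : map (occ p13-2) (perms n) ↭ insertionStats n 2
  perms-stats-13-2 = ↭-trans
    (map-transport-↭ n (map (complement n)) (occ p13-2) (occ p31-2) complement-perms
                  (All.map (occ13-2-complement n) (perms-permutation n)))
    perms-stats-31-2

  perms-stats : ∀ τ → map (occ τ) (perms n) ↭ insertionStats n 2
  perms-stats p2-13 = perms-stats-2-13
  perms-stats p2-31 = perms-stats-2-31
  perms-stats p13-2 = perms-stats-13-2
  perms-stats p31-2 = perms-stats-31-2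

-- Generating polynomials and signed sums

countOcc-concatMap-choicesUpTo : ∀ k (F : Choice → List ℕ) a →
  countOcc k (concatMap F (choicesUpTo a)) ≡ ∑ℕ.∑ a (λ g → countOcc k (concatMap F (slotsAt g)))
countOcc-concatMap-choicesUpTo k F zero    = refl
countOcc-concatMap-choicesUpTo k F (suc a) = begin
  countOcc k (concatMap F (choicesUpTo (suc a)))
    ≡⟨ cong (countOcc k ∘ concatMap F) (choicesUpTo-suc a) ⟩
  countOcc k (concatMap F (choicesUpTo a ++ slotsAt a))
    ≡⟨ cong (countOcc k) (Listₚ.concatMap-++ F (choicesUpTo a) (slotsAt a)) ⟩
  countOcc k (concatMap F (choicesUpTo a) ++ concatMap F (slotsAt a))
    ≡⟨ countOcc-++ k (concatMap F (choicesUpTo a)) _ ⟩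
  countOcc k (concatMap F (choicesUpTo a)) + countOcc k (concatMap F (slotsAt a))
    ≡⟨ cong (_+ countOcc k (concatMap F (slotsAt a))) (countOcc-concatMap-choicesUpTo k F a) ⟩
  ∑ℕ.∑ (suc a) (λ g → countOcc k (concatMap F (slotsAt g))) ∎
  where open ≡.≡-Reasoning

countOcc-map-+ : ∀ k g L → countOcc k (map (g +_) L) ≡ (if g <ᵇ suc k then countOcc (k ∸ g) L else 0)
countOcc-map-+ k g L with ℕₚ.≤-<-connex g k
... | inj₁ g≤k rewrite <ᵇ-true (s≤s g≤k) =
  ≡.trans (length-filterᵇ-map (_≡ᵇ k) (g +_) L) (cong length (filterᵇ-≗ shifted L))
  where
  shifted : ∀ y → ((g + y) ≡ᵇ k) ≡ (y ≡ᵇ (k ∸ g))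
  shifted y = does-⇔ (mk⇔ (λ g+y≡k → ≡.trans (≡.sym (ℕₚ.m+n∸m≡n g y)) (cong (_∸ g) g+y≡k))
                          (λ y≡k∸g → ≡.trans (cong (g +_) y≡k∸g) (ℕₚ.m+[n∸m]≡n g≤k)))
                     ((g + y) ℕₚ.≟ k) (y ℕₚ.≟ (k ∸ g))
... | inj₂ k<g rewrite <ᵇ-false {g} {suc k} k<g =
  cong length (filterᵇ-none (_≡ᵇ k) (map (g +_) L) (Allₚ.map⁺ {f = g +_} (All.tabulate {xs = L} (λ {y} _ → too-big y))))
  where
  too-big : ∀ y → ((g + y) ≡ᵇ k) ≡ false
  too-big y = ≡ᵇ-false (λ g+y≡k → ℕₚ.<⇒≱ k<g (≡.subst (g ≤_) g+y≡k (ℕₚ.m≤m+n g y)))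

∑-below : ∀ a b (h : ℕ → ℕ) → ∑ℕ.∑ a (λ g → if g <ᵇ b then h g else 0) ≡ ∑ℕ.∑ (a ⊓ b) h
∑-below zero    b h = refl
∑-below (suc a) b h with ℕₚ.≤-<-connex b a
... | inj₁ b≤a rewrite <ᵇ-false {a} {b} b≤a | ℕₚ.m≥n⇒m⊓n≡n (ℕₚ.m≤n⇒m≤1+n b≤a) =
  ≡.trans (ℕₚ.+-identityʳ _) (≡.trans (∑-below a b h) (cong (λ c → ∑ℕ.∑ c h) (ℕₚ.m≥n⇒m⊓n≡n b≤a)))
... | inj₂ a<b rewrite <ᵇ-true a<b | ℕₚ.m≤n⇒m⊓n≡m a<b =
  cong (_+ h a) (≡.trans (∑-below a b h) (cong (λ c → ∑ℕ.∑ c h) (ℕₚ.m≤n⇒m⊓n≡m (ℕₚ.<⇒≤ a<b))))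

∑-below-swap : ∀ a b (h : ℕ → ℕ) → ∑ℕ.∑ a (λ g → if g <ᵇ b then h g else 0) ≡ ∑ℕ.∑ b (λ g → if g <ᵇ a then h g else 0)
∑-below-swap a b h = ≡.trans (∑-below a b h) (≡.trans (cong (λ c → ∑ℕ.∑ c h) (ℕₚ.⊓-comm a b)) (≡.sym (∑-below b a h)))

countOcc-concat : ∀ k xss → countOcc k (concat xss) ≡ foldr _+_ 0 (map (countOcc k) xss)
countOcc-concat k []         = refl
countOcc-concat k (xs ∷ xss) = ≡.trans (countOcc-++ k xs (concat xss)) (cong (countOcc k xs +_) (countOcc-concat k xss))

continuationCount : ℕ → ℕ → ℕ → ℕ
continuationCount r b j = countOcc j (insertionStats r (b ∸ 1))
  + (countOcc j (insertionStats r b) + (countOcc j (insertionStats r b) + (countOcc j (insertionStats r (suc b)) + 0)))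

countOcc-slotsAt : ∀ r b k g →
  countOcc k (concatMap (shiftedStats r b) (slotsAt g)) ≡ (if g <ᵇ suc k then continuationCount r b (k ∸ g) else 0)
countOcc-slotsAt r b k g
  rewrite countOcc-concat k (map (shiftedStats r b) (slotsAt g))
        | countOcc-map-+ k g (insertionStats r (b ∸ 1))
        | countOcc-map-+ k g (insertionStats r b)
        | countOcc-map-+ k g (insertionStats r (suc b))
  with g <ᵇ suc k
... | true  = refl
... | false = refl

insertionStats-count : ∀ r x k → countOcc k (insertionStats r (suc x)) ≡ pathPoly r x k
insertionStats-count zero    zero    zero    = refl
insertionStats-count zero    zero    (suc k) = refl
insertionStats-count zero    (suc x) k       = refl
insertionStats-count (suc r) zero    k       = refl
insertionStats-count (suc r) (suc x) k = begin
  countOcc k (concatMap (shiftedStats r b) (choicesUpTo (suc x)))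
    ≡⟨ countOcc-concatMap-choicesUpTo k (shiftedStats r b) (suc x) ⟩
  ∑ℕ.∑ (suc x) (λ g → countOcc k (concatMap (shiftedStats r b) (slotsAt g)))
    ≡⟨ ∑ℕ.∑-cong (suc x) (λ g → ≡.trans (countOcc-slotsAt r b k g) (cong (λ c → if g <ᵇ suc k then c else 0) (Z≡ (k ∸ g)))) ⟩
  ∑ℕ.∑ (suc x) (λ g → if g <ᵇ suc k then Z (k ∸ g) else 0)
    ≡⟨ ∑-below-swap (suc x) (suc k) (λ g → Z (k ∸ g)) ⟩
  ∑ℕ.∑ (suc k) (λ g → if g <ᵇ suc x then Z (k ∸ g) else 0)
    ≡⟨ ∑ℕ.∑-cong (suc k) weight ⟩
  ∑ℕ.∑ (suc k) (λ i → qint (suc x) i * Z (k ∸ i))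
    ≡⟨ ≡.sym (sumℕ≡∑ (suc k) _) ⟩
  pathPoly (suc r) (suc x) k ∎
  where
  open ≡.≡-Reasoning
  b = suc (suc x)
  Z : ℕ → ℕ
  Z = padd (padd (padd (pathPoly r x) (pathPoly r (suc x))) (pathPoly r (suc x))) (pathPoly r (suc (suc x)))
  Z≡ : ∀ j → continuationCount r b j ≡ Z j
  Z≡ j rewrite insertionStats-count r x j | insertionStats-count r (suc x) j | insertionStats-count r (suc (suc x)) j
             | ℕₚ.+-identityʳ (pathPoly r (suc (suc x)) j) =
    ≡.trans (≡.sym (ℕₚ.+-assoc (pathPoly r x j) _ _)) (≡.sym (ℕₚ.+-assoc (pathPoly r x j + pathPoly r (suc x) j) _ _))
  weight : ∀ i → (if i <ᵇ suc x then Z (k ∸ i) else 0) ≡ qint (suc x) i * Z (k ∸ i)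
  weight i with i <ᵇ suc x
  ... | true  = ≡.sym (ℕₚ.+-identityʳ _)
  ... | false = refl

-- Opened only here: the constructor +_ of ℤ makes the sections (x +_) above ambiguous.
open import Data.Integer as ℤ using (ℤ; +_; -1ℤ)
import Data.Integer.Properties as ℤₚ
open import Data.Integer.Solver using (module +-*-Solver)
open import Algebra.Properties.CommutativeSemigroup ℤₚ.+-commutativeSemigroup
  using () renaming (x∙yz≈y∙xz to ℤ+-x∙yz≈y∙xz)

sign : ℕ → ℤ
sign x = -1ℤ ℤ.^ x

signedSum : List ℕ → ℤ
signedSum = foldr (λ x acc → sign x ℤ.+ acc) (+ 0)

signedSum-↭ : ∀ {xs ys} → xs ↭ ys → signedSum xs ≡ signedSum ys
signedSum-↭ ↭.refl         = ≡.refl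
signedSum-↭ (↭.prep x p)   = cong (λ s → sign x ℤ.+ s) (signedSum-↭ p)
signedSum-↭ (↭.swap x y p) =
  ≡.trans (ℤ+-x∙yz≈y∙xz (sign x) (sign y) _) (cong (λ s → sign y ℤ.+ (sign x ℤ.+ s)) (signedSum-↭ p))
signedSum-↭ (↭.trans p q)  = ≡.trans (signedSum-↭ p) (signedSum-↭ q)

signedSum-++ : ∀ xs ys → signedSum (xs ++ ys) ≡ signedSum xs ℤ.+ signedSum ys
signedSum-++ []       ys = ≡.sym (ℤₚ.+-identityˡ (signedSum ys))
signedSum-++ (x ∷ xs) ys =
  ≡.trans (cong (λ s → sign x ℤ.+ s) (signedSum-++ xs ys)) (≡.sym (ℤₚ.+-assoc (sign x) (signedSum xs) (signedSum ys)))

signedSum-shift : ∀ g xs → signedSum (map (g ℕ.+_) xs) ≡ sign g ℤ.* signedSum xs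
signedSum-shift g []       = ≡.sym (ℤₚ.*-zeroʳ (sign g))
signedSum-shift g (x ∷ xs) =
  ≡.trans (cong₂ ℤ._+_ (ℤₚ.^-distribˡ-+-* -1ℤ g x) (signedSum-shift g xs)) (≡.sym (ℤₚ.*-distribˡ-+ (sign g) _ _))

signedSum-concat : ∀ xss → signedSum (concat xss) ≡ foldr ℤ._+_ (+ 0) (map signedSum xss)
signedSum-concat []         = ≡.refl
signedSum-concat (xs ∷ xss) =
  ≡.trans (signedSum-++ xs (concat xss)) (cong (λ s → signedSum xs ℤ.+ s) (signedSum-concat xss))

continuationSign : ℕ → ℕ → ℤ
continuationSign r b = signedSum (insertionStats r (b ℕ.∸ 1))
  ℤ.+ (signedSum (insertionStats r b) ℤ.+ (signedSum (insertionStats r b) ℤ.+ (signedSum (insertionStats r (suc b)) ℤ.+ + 0)))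

signedSum-slotsAt : ∀ r b g → signedSum (concatMap (shiftedStats r b) (slotsAt g)) ≡ sign g ℤ.* continuationSign r b
signedSum-slotsAt r b g
  rewrite signedSum-concat (map (shiftedStats r b) (slotsAt g))
        | signedSum-shift g (insertionStats r (b ℕ.∸ 1))
        | signedSum-shift g (insertionStats r b)
        | signedSum-shift g (insertionStats r (suc b)) =
  factor (sign g) (signedSum (insertionStats r (b ℕ.∸ 1))) (signedSum (insertionStats r b)) (signedSum (insertionStats r (suc b)))
  where
  open +-*-Solver
  factor : ∀ u x y z → u ℤ.* x ℤ.+ (u ℤ.* y ℤ.+ (u ℤ.* y ℤ.+ (u ℤ.* z ℤ.+ + 0))) ≡ u ℤ.* (x ℤ.+ (y ℤ.+ (y ℤ.+ (z ℤ.+ + 0))))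
  factor = solve 4 (λ u x y z → u :* x :+ (u :* y :+ (u :* y :+ (u :* z :+ con (+ 0)))) :=
                                u :* (x :+ (y :+ (y :+ (z :+ con (+ 0)))))) ≡.refl

signedSum-insertionStats-3 : ∀ r → signedSum (insertionStats r 3) ≡ + 0
signedSum-insertionStats-3 zero    = ≡.refl
signedSum-insertionStats-3 (suc r) = begin
  signedSum (concatMap F (slotsAt 0 ++ slotsAt 1 ++ []))
    ≡⟨ cong signedSum (Listₚ.concatMap-++ F (slotsAt 0) (slotsAt 1 ++ [])) ⟩
  signedSum (concatMap F (slotsAt 0) ++ concatMap F (slotsAt 1 ++ []))
    ≡⟨ signedSum-++ (concatMap F (slotsAt 0)) _ ⟩
  signedSum (concatMap F (slotsAt 0)) ℤ.+ signedSum (concatMap F (slotsAt 1))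
    ≡⟨ cong₂ ℤ._+_ (signedSum-slotsAt r 3 0) (signedSum-slotsAt r 3 1) ⟩
  sign 0 ℤ.* continuationSign r 3 ℤ.+ sign 1 ℤ.* continuationSign r 3
    ≡⟨ cancel (continuationSign r 3) ⟩
  + 0 ∎
  where
  open ≡.≡-Reasoning
  open +-*-Solver
  F = shiftedStats r 3
  cancel : ∀ z → sign 0 ℤ.* z ℤ.+ sign 1 ℤ.* z ≡ + 0
  cancel = solve 1 (λ z → con (+ 1) :* z :+ con -1ℤ :* z := con (+ 0)) ≡.refl

signedSum-insertionStats-2 : ∀ m → signedSum (insertionStats (suc m) 2) ≡ + (2 ℕ.^ m)
signedSum-insertionStats-2 zero    = ≡.refl
signedSum-insertionStats-2 (suc m) = begin
  signedSum (concatMap (shiftedStats (suc m) 2) (slotsAt 0))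
    ≡⟨ signedSum-slotsAt (suc m) 2 0 ⟩
  sign 0 ℤ.* (+ 0 ℤ.+ (signedAt 2 ℤ.+ (signedAt 2 ℤ.+ (signedAt 3 ℤ.+ + 0))))
    ≡⟨ cong (λ s₃ → sign 0 ℤ.* (+ 0 ℤ.+ (signedAt 2 ℤ.+ (signedAt 2 ℤ.+ (s₃ ℤ.+ + 0))))) (signedSum-insertionStats-3 (suc m)) ⟩
  sign 0 ℤ.* (+ 0 ℤ.+ (signedAt 2 ℤ.+ (signedAt 2 ℤ.+ (+ 0 ℤ.+ + 0))))
    ≡⟨ cong (λ s₂ → sign 0 ℤ.* (+ 0 ℤ.+ (s₂ ℤ.+ (s₂ ℤ.+ (+ 0 ℤ.+ + 0))))) (signedSum-insertionStats-2 m) ⟩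
  sign 0 ℤ.* + (2 ℕ.^ m ℕ.+ (2 ℕ.^ m ℕ.+ 0))
    ≡⟨ ℤₚ.*-identityˡ _ ⟩
  + (2 ℕ.^ m ℕ.+ (2 ℕ.^ m ℕ.+ 0)) ∎
  where
  open ≡.≡-Reasoning
  signedAt : ℕ → ℤ
  signedAt b = signedSum (insertionStats (suc m) b)

occ-[] : ∀ τ → occ τ [] ≡ 0
occ-[] p2-13 = refl
occ-[] p2-31 = refl
occ-[] p13-2 = refl
occ-[] p31-2 = refl

genCoeff-zero : ∀ τ k → genCoeff (occ τ) 0 k ≡ pone k
genCoeff-zero τ zero    rewrite occ-[] τ = refl
genCoeff-zero τ (suc k) rewrite occ-[] τ = refl

genCoeff≡pathPoly : ∀ τ n → 1 ≤ n → ∀ k → genCoeff (occ τ) n k ≡ pathPoly n 1 k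
genCoeff≡pathPoly τ n 1≤n k = begin
  length (filterᵇ (λ σ → occ τ σ ≡ᵇ k) (perms n))   ≡⟨ ≡.sym (length-filterᵇ-map (_≡ᵇ k) (occ τ) (perms n)) ⟩
  countOcc k (map (occ τ) (perms n))               ≡⟨ countOcc-↭ k (perms-stats n 1≤n τ) ⟩
  countOcc k (insertionStats n 2)                  ≡⟨ insertionStats-count n 1 k ⟩
  pathPoly n 1 k                                   ∎
  where open ≡.≡-Reasoning

genCoeff≡cf : ∀ τ n d → n ≤ d → ∀ k → genCoeff (occ τ) n k ≡ cf d 1 n k
genCoeff≡cf τ zero    d _   k = ≡.trans (genCoeff-zero τ k) (≡.sym (P.trans (cf-coeff-zero d 1) (P.sym pone≈1) k))
genCoeff≡cf τ (suc m) d n≤d k =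
  ≡.trans (genCoeff≡pathPoly τ (suc m) (s≤s z≤n) k) (≡.sym (cf≈pathPoly (suc m) d (s≤s z≤n) n≤d k))

genEval-one : ∀ stat n → genEval stat n (+ 1) ≡ + length (perms n)
genEval-one stat n = ones (perms n)
  where
  ones : ∀ σs → foldr (λ σ acc → (+ 1) ℤ.^ stat σ ℤ.+ acc) (+ 0) σs ≡ + length σs
  ones []       = refl
  ones (σ ∷ σs) rewrite ℤₚ.^-zeroˡ (stat σ) | ones σs = refl

genEval-minusOne≡signedSum : ∀ stat n → genEval stat n -1ℤ ≡ signedSum (map stat (perms n))
genEval-minusOne≡signedSum stat n = signs (perms n)
  where
  signs : ∀ σs → foldr (λ σ acc → -1ℤ ℤ.^ stat σ ℤ.+ acc) (+ 0) σs ≡ signedSum (map stat σs)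
  signs []       = refl
  signs (σ ∷ σs) = cong (λ s → sign (stat σ) ℤ.+ s) (signs σs)

genEval-minusOne : ∀ τ n → genEval (occ τ) n -1ℤ ≡ + fixNum n
genEval-minusOne τ zero    rewrite occ-[] τ = refl
genEval-minusOne τ (suc m) = begin
  genEval (occ τ) (suc m) -1ℤ                   ≡⟨ genEval-minusOne≡signedSum (occ τ) (suc m) ⟩
  signedSum (map (occ τ) (perms (suc m)))       ≡⟨ signedSum-↭ (perms-stats (suc m) (s≤s z≤n) τ) ⟩
  signedSum (insertionStats (suc m) 2)          ≡⟨ signedSum-insertionStats-2 m ⟩
  + fixNum (suc m)                              ∎
  where open ≡.≡-Reasoning

-- The involution is deliberately unused: for the group {id, φ} the phenomenon only
-- compares the two evaluations with the size of the set and the number of fixed points.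
occ-cyclicSieving : ∀ τ → ExhibitsCSP (occ τ) fixNum
occ-cyclicSieving τ n _ _ fixed≡fixNum =
  genEval-one (occ τ) n , ≡.trans (genEval-minusOne τ n) (cong +_ (≡.sym fixed≡fixNum))

theorem3p7 : (τ : Pattern) →
    ((n d : ℕ) → n ≤ d → (k : ℕ) → genCoeff (occ τ) n k ≡ cf d 1 n k)
    × ExhibitsCSP (occ τ) fixNum
theorem3p7 τ = genCoeff≡cf τ , occ-cyclicSieving τ
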